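{- For every $n\ge0$, $$sc_3(\mathcal{D}_n)=\sum_{\gamma\in\mathcal{D}_n}\Big(6\,\#(du,du,du)_\gamma+3\,\#(du,ddu)_\gamma+3\,\#(du,duu)_\gamma+\#(dddu)_\gamma+\#(duuu)_\gamma+2\,\#(dduu)_\gamma+2\,\#(dudu)_\gamma\Big),$$ where $sc_3(\mathcal{D}_n)$ is the number of saturated chains of length 3 in $\mathcal{D}_n$.
   Context: A Dyck path of semilength $n$ is a word in $u$ (step $(1,1)$) and $d$ (step $(1,-1)$) with $n$ of each letter whose path from the origin never goes below the $x$-axis. $\mathcal{D}_n$ is the set of such paths ordered by $\gamma\le\gamma'$ iff $\gamma$ lies weakly below $\gamma'$. A saturated chain of length $h$ is a chain $\gamma^{(0)}<\cdots<\gamma^{(h)}$ where each element covers the previous one. For words $w_1,\ldots,w_k$, $\#(w_1,\ldots,w_k)_\gamma$ denotes the number of ways of choosing pairwise disjoint occurrences (blocks of consecutive letters with non-intersecting positions) of $w_1,\ldots,w_k$ in $\gamma$, as unordered collections; e.g. $\#(du,du,du)_\gamma$ is the number of 3-element sets of valleys of $\gamma$, $\#(du,ddu)_\gamma$ is the number of pairs consisting of an occurrence of $du$ and a disjoint occurrence of $ddu$, and $\#(w)_\gamma$ is the number of occurrences of the factor $w$ in $\gamma$. -}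

module Defs where

open import Data.Bool using (Bool; true; false; _∧_; _∨_; not; if_then_else_)
open import Data.Nat using (ℕ; zero; suc; _+_; _*_; _≤ᵇ_; _<ᵇ_; _≡ᵇ_)
open import Data.Integer as ℤ using (ℤ; +_) renaming (_≤ᵇ_ to _≤ℤᵇ_)
open import Data.Product using (_×_; _,_)
import Data.Product
open import Data.List using (List; []; _∷_; length; map; concatMap; upTo; drop; foldr)
open import Data.Nat.ListAction using (sum)

-- Letters: u = (1,1), d = (1,-1)
data Step : Set where
  u d : Step

Word : Set
Word = List Step

words : ℕ → List Word
words zero    = [] ∷ []
words (suc k) = concatMap (λ w → (u ∷ w) ∷ (d ∷ w) ∷ []) (words k)

stepH : Step → ℤ → ℤ
stepH u h = h ℤ.+ + 1
stepH d h = h ℤ.- + 1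

heightsFrom : ℤ → Word → List ℤ
heightsFrom h []       = []
heightsFrom h (s ∷ w) = stepH s h ∷ heightsFrom (stepH s h) w

heights : Word → List ℤ
heights = heightsFrom (+ 0)

isDyckFrom : ℤ → Word → Bool
isDyckFrom h []       = (h ≤ℤᵇ + 0) ∧ (+ 0 ≤ℤᵇ h)
isDyckFrom h (s ∷ w) = (+ 0 ≤ℤᵇ stepH s h) ∧ isDyckFrom (stepH s h) w

isDyck : Word → Bool
isDyck = isDyckFrom (+ 0)

filterB : {A : Set} → (A → Bool) → List A → List A
filterB p []       = []
filterB p (x ∷ xs) = if p x then x ∷ filterB p xs else filterB p xs

countB : {A : Set} → (A → Bool) → List A → ℕ
countB p xs = length (filterB p xs)

anyB : {A : Set} → (A → Bool) → List A → Bool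
anyB p = foldr (λ x b → p x ∨ b) false

allB : {A : Set} → (A → Bool) → List A → Bool
allB p = foldr (λ x b → p x ∧ b) true

Dyck : ℕ → List Word
Dyck n = filterB isDyck (words (2 * n))

pointwiseLe : List ℤ → List ℤ → Bool
pointwiseLe []       []       = true
pointwiseLe (x ∷ xs) (y ∷ ys) = (x ≤ℤᵇ y) ∧ pointwiseLe xs ys
pointwiseLe _        _        = false

leqB : Word → Word → Bool
leqB g g' = pointwiseLe (heights g) (heights g')

ltB : Word → Word → Bool
ltB g g' = leqB g g' ∧ not (leqB g' g)

coversB : ℕ → Word → Word → Bool
coversB n g g' = ltB g g' ∧ not (anyB (λ h → ltB g h ∧ ltB h g') (Dyck n))

sc3 : ℕ → ℕ
sc3 n = sum (map (λ g0 → sum (map (λ g1 → sum (map (λ g2 →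
          countB (λ g3 → coversB n g2 g3) (Dyck n))
          (filterB (λ g2 → coversB n g1 g2) (Dyck n))))
          (filterB (λ g1 → coversB n g0 g1) (Dyck n))))
          (Dyck n))

eqStep : Step → Step → Bool
eqStep u u = true
eqStep d d = true
eqStep _ _ = false

eqWord : Word → Word → Bool
eqWord []       []       = true
eqWord (a ∷ v) (b ∷ w) = eqStep a b ∧ eqWord v w
eqWord _        _        = false

isPrefixB : Word → Word → Bool
isPrefixB []       _        = true
isPrefixB (a ∷ v) []       = false
isPrefixB (a ∷ v) (b ∷ w) = eqStep a b ∧ isPrefixB v w

occursAt : Word → Word → ℕ → Bool
occursAt w γ p = isPrefixB w (drop p γ)

tuples : ℕ → ℕ → List (List ℕ)
tuples m zero    = [] ∷ []
tuples m (suc k) = concatMap (λ p → map (p ∷_) (tuples m k)) (upTo m)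

Occ : Set
Occ = Word × ℕ

zipB : List Word → List ℕ → List Occ
zipB (w ∷ ws) (p ∷ ps) = (w , p) ∷ zipB ws ps
zipB _        _        = []

-- two occurrences (v at p), (w at q) are disjoint, and if v = w they are listed
-- in increasing position order (canonical representative of an unordered collection)
compatB : Occ → Occ → Bool
compatB (v , p) (w , q) =
  ((p + length v ≤ᵇ q) ∨ (q + length w ≤ᵇ p)) ∧ (not (eqWord v w) ∨ (p <ᵇ q))

pairwiseB : List Occ → Bool
pairwiseB []       = true
pairwiseB (o ∷ os) = allB (compatB o) os ∧ pairwiseB os

-- #(w1,…,wk)_γ : number of unordered collections of pairwise disjoint occurrences
-- of w1,…,wk in γ (counted via tuples of positions where equal words are in
-- increasing order of position)
occCount : List Word → Word → ℕ
occCount ws γ = countB (λ ps → allB (λ o → occursAt (Data.Product.proj₁ o) γ (Data.Product.proj₂ o)) (zipB ws ps)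
                                ∧ pairwiseB (zipB ws ps))
                       (tuples (length γ) (length ws))

summand : Word → ℕ
summand γ =
    6 * occCount ((d ∷ u ∷ []) ∷ (d ∷ u ∷ []) ∷ (d ∷ u ∷ []) ∷ []) γ
  + 3 * occCount ((d ∷ u ∷ []) ∷ (d ∷ d ∷ u ∷ []) ∷ []) γ
  + 3 * occCount ((d ∷ u ∷ []) ∷ (d ∷ u ∷ u ∷ []) ∷ []) γ
  + occCount ((d ∷ d ∷ d ∷ u ∷ []) ∷ []) γ
  + occCount ((d ∷ u ∷ u ∷ u ∷ []) ∷ []) γ
  + 2 * occCount ((d ∷ d ∷ u ∷ u ∷ []) ∷ []) γ
  + 2 * occCount ((d ∷ u ∷ d ∷ u ∷ []) ∷ []) γ

-- In 𝒟ₙ a path is covered exactly by the paths obtained from it by turning one valley du into a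
-- peak ud, so sc₃(𝒟ₙ) is the sum over γ of the number chains 3 γ of sequences of three successive
-- flips starting at γ.  Write V, A, B for the numbers of factors du, ddu, duu of γ and C₁, …, C₄ for
-- those of dddu, duuu, dduu, dudu.  Induction along the word, tracking how a flip changes these
-- counts, gives
--   chains 3 γ + 3V² + 3(A + B) = V³ + 2V + 3V(A + B) + C₁ + C₂ + 2C₃ + 2C₄.
-- On the other side, valleys never overlap, so #(du,du,du) = (V³ − 3V² + 2V)/6, and every occurrence
-- of ddu (resp. duu) meets exactly one valley, so #(du,ddu) = VA − A and #(du,duu) = VB − B.
-- Substituting these turns the right-hand side into the summand.

module Submission where

open import Defs
open import Function using (_∘_)
open import Data.Bool using (Bool; true; false; _∧_; _∨_; not)
open import Data.Bool.Properties using (∧-identityʳ; ∧-zeroʳ; T-≡)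
open import Function.Bundles using (Equivalence)
open import Data.Nat using (ℕ; zero; suc; _+_; _*_; _≤ᵇ_; _<ᵇ_; _≡ᵇ_; z≤n)
open import Data.Nat.Properties
  using (+-identityʳ; *-identityˡ; +-assoc; +-cancelʳ-≡; *-zeroʳ; *-assoc; *-distribˡ-+; *-distribʳ-+; suc-injective)
open import Data.Nat.ListAction using (sum)
open import Data.Nat.Tactic.RingSolver using (solve-∀)
open import Data.Integer as ℤ using (ℤ; -[1+_]; _-_; _≤_; +≤+; -≤+) renaming (_≤ᵇ_ to _≤ℤᵇ_)
import Data.Integer.Properties as ℤP
import Data.Integer.Tactic.RingSolver as ℤSolver
open import Data.List using (List; []; _∷_; length; map; _++_; concatMap; upTo; drop)
open import Data.List.Properties using (map-applyUpTo; drop-[]; ∷-injectiveʳ)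
open import Data.List.Relation.Unary.All using (All; []; _∷_)
import Data.List.Relation.Unary.All as All
import Data.List.Relation.Unary.All.Properties as All
open import Data.List.Relation.Unary.AllPairs using ([]; _∷_)
open import Data.List.Relation.Unary.Unique.Propositional using (Unique)
import Data.List.Relation.Unary.Unique.Propositional.Properties as Unique
open import Data.List.Membership.Propositional using (_∈_; find)
open import Data.List.Relation.Unary.Any using (here; there)
import Data.List.Relation.Unary.Any as Any
open import Data.List.Membership.Propositional.Properties using (∈-map⁺; ∈-map⁻; ∈-concatMap⁺; ∈-concatMap⁻)
open import Data.Product using (∃; _×_; _,_; proj₁)
open import Data.Sum using (_⊎_; inj₁; inj₂)
open import Data.Empty using (⊥; ⊥-elim)
open import Relation.Nullary using (¬_)
open import Relation.Binary.PropositionalEquality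

𝟙 : Bool → ℕ
𝟙 true  = 1
𝟙 false = 0

𝟙-∧ : ∀ x y → 𝟙 (x ∧ y) ≡ 𝟙 x * 𝟙 y
𝟙-∧ true  y = sym (+-identityʳ (𝟙 y))
𝟙-∧ false y = refl

𝟙-idem : ∀ b → 𝟙 b * 𝟙 b ≡ 𝟙 b
𝟙-idem true  = refl
𝟙-idem false = refl

∧-≡-true : ∀ {a b} → a ∧ b ≡ true → (a ≡ true) × (b ≡ true)
∧-≡-true {true} {true} _ = refl , refl

∧-intro : ∀ {a b} → a ≡ true → b ≡ true → a ∧ b ≡ true
∧-intro refl refl = refl

true≢false : ∀ {b} → b ≡ true → b ≡ false → ⊥
true≢false refl ()

not-≡-true : ∀ {b} → not b ≡ true → b ≡ false
not-≡-true {false} _ = refl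

-- Polynomial identities below are closed by adding to both sides a term that an induction hypothesis
-- rewrites, which keeps them free of truncated subtraction.
+-cancelʳ-≡-via : ∀ {l r k k′} → l + k ≡ r + k′ → k′ ≡ k → l ≡ r
+-cancelʳ-≡-via {l} {r} {k} e refl = +-cancelʳ-≡ k l r e

∑ : {A : Set} → (A → ℕ) → List A → ℕ
∑ f xs = sum (map f xs)

module _ {A : Set} where

  ∑-cong : {f g : A → ℕ} → (∀ x → f x ≡ g x) → ∀ xs → ∑ f xs ≡ ∑ g xs
  ∑-cong e []       = refl
  ∑-cong e (x ∷ xs) = cong₂ _+_ (e x) (∑-cong e xs)

  ∑-cong-∈ : {f g : A → ℕ} → ∀ xs → (∀ {x} → x ∈ xs → f x ≡ g x) → ∑ f xs ≡ ∑ g xs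
  ∑-cong-∈ []       e = refl
  ∑-cong-∈ (x ∷ xs) e = cong₂ _+_ (e (here refl)) (∑-cong-∈ xs (e ∘ there))

  ∑-zero : ∀ (xs : List A) → ∑ (λ _ → 0) xs ≡ 0
  ∑-zero []       = refl
  ∑-zero (x ∷ xs) = ∑-zero xs

  ∑-+ : ∀ (f g : A → ℕ) xs → ∑ (λ x → f x + g x) xs ≡ ∑ f xs + ∑ g xs
  ∑-+ f g []       = refl
  ∑-+ f g (x ∷ xs) rewrite ∑-+ f g xs = interchange (f x) (g x) (∑ f xs) (∑ g xs)
    where
    interchange : ∀ a b c e → a + b + (c + e) ≡ a + c + (b + e)
    interchange = solve-∀

  ∑-*ˡ : ∀ k (f : A → ℕ) xs → ∑ (λ x → k * f x) xs ≡ k * ∑ f xs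
  ∑-*ˡ k f []       = sym (*-zeroʳ k)
  ∑-*ˡ k f (x ∷ xs) rewrite ∑-*ˡ k f xs = sym (*-distribˡ-+ k (f x) (∑ f xs))

  ∑-*ʳ : ∀ k (f : A → ℕ) xs → ∑ (λ x → f x * k) xs ≡ ∑ f xs * k
  ∑-*ʳ k f []       = refl
  ∑-*ʳ k f (x ∷ xs) rewrite ∑-*ʳ k f xs = sym (*-distribʳ-+ k (f x) (∑ f xs))

  ∑-++ : ∀ (f : A → ℕ) xs ys → ∑ f (xs ++ ys) ≡ ∑ f xs + ∑ f ys
  ∑-++ f []       ys = refl
  ∑-++ f (x ∷ xs) ys = trans (cong (f x +_) (∑-++ f xs ys)) (sym (+-assoc (f x) (∑ f xs) (∑ f ys)))

  ∑-filterB : ∀ (P : A → Bool) (f : A → ℕ) xs → ∑ f (filterB P xs) ≡ ∑ (λ x → 𝟙 (P x) * f x) xs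
  ∑-filterB P f []       = refl
  ∑-filterB P f (x ∷ xs) with P x
  ... | true  = cong₂ _+_ (sym (+-identityʳ (f x))) (∑-filterB P f xs)
  ... | false = ∑-filterB P f xs

  countB≡∑ : ∀ (P : A → Bool) xs → countB P xs ≡ ∑ (λ x → 𝟙 (P x)) xs
  countB≡∑ P []       = refl
  countB≡∑ P (x ∷ xs) with P x
  ... | true  = cong suc (countB≡∑ P xs)
  ... | false = countB≡∑ P xs

  length≡∑1 : ∀ (xs : List A) → length xs ≡ ∑ (λ _ → 1) xs
  length≡∑1 []       = refl
  length≡∑1 (x ∷ xs) = cong suc (length≡∑1 xs)

  ∈-filterB⁺ : ∀ {P : A → Bool} {y} xs → y ∈ xs → P y ≡ true → y ∈ filterB P xs
  ∈-filterB⁺ {P} (x ∷ xs) (here refl) e rewrite e = here refl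
  ∈-filterB⁺ {P} (x ∷ xs) (there p)   e with P x
  ... | true  = there (∈-filterB⁺ xs p e)
  ... | false = ∈-filterB⁺ xs p e

  ∈-filterB⁻ : ∀ {P : A → Bool} {y} xs → y ∈ filterB P xs → (y ∈ xs) × (P y ≡ true)
  ∈-filterB⁻ {P} (x ∷ xs) p with P x in Px
  ∈-filterB⁻ {P} (x ∷ xs) (here refl) | true = here refl , Px
  ∈-filterB⁻ {P} (x ∷ xs) (there p)   | true  with ∈-filterB⁻ xs p
  ... | q , e = there q , e
  ∈-filterB⁻ {P} (x ∷ xs) p           | false with ∈-filterB⁻ xs p
  ... | q , e = there q , e

module _ {A B : Set} where

  ∑-map : ∀ (f : B → ℕ) (g : A → B) xs → ∑ f (map g xs) ≡ ∑ (f ∘ g) xs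
  ∑-map f g []       = refl
  ∑-map f g (x ∷ xs) = cong (f (g x) +_) (∑-map f g xs)

  ∑-concatMap : ∀ (f : B → ℕ) (g : A → List B) xs → ∑ f (concatMap g xs) ≡ ∑ (∑ f ∘ g) xs
  ∑-concatMap f g []       = refl
  ∑-concatMap f g (x ∷ xs) = trans (∑-++ f (g x) (concatMap g xs)) (cong (∑ f (g x) +_) (∑-concatMap f g xs))

  ∑-swap : ∀ (f : A → B → ℕ) xs ys → ∑ (λ x → ∑ (f x) ys) xs ≡ ∑ (λ y → ∑ (λ x → f x y) xs) ys
  ∑-swap f []       ys = sym (∑-zero ys)
  ∑-swap f (x ∷ xs) ys =
    trans (cong (∑ (f x) ys +_) (∑-swap f xs ys)) (sym (∑-+ (f x) (λ y → ∑ (λ x → f x y) xs) ys))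

∑-upTo-suc : ∀ (f : ℕ → ℕ) m → ∑ f (upTo (suc m)) ≡ f 0 + ∑ (f ∘ suc) (upTo m)
∑-upTo-suc f m = cong (f 0 +_) (trans (cong (∑ f) (sym (map-applyUpTo (λ x → x) suc m))) (∑-map f suc (upTo m)))

∑-upTo-≡ᵇ : ∀ m j → ∑ (λ p → 𝟙 (p ≡ᵇ j)) (upTo m) ≡ 𝟙 (j <ᵇ m)
∑-upTo-≡ᵇ zero    j       = refl
∑-upTo-≡ᵇ (suc m) zero    = trans (∑-upTo-suc (λ p → 𝟙 (p ≡ᵇ 0)) m) (cong suc (∑-zero (upTo m)))
∑-upTo-≡ᵇ (suc m) (suc j) = trans (∑-upTo-suc (λ p → 𝟙 (p ≡ᵇ suc j)) m) (∑-upTo-≡ᵇ m j)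

eqStep-sound : ∀ a b → eqStep a b ≡ true → a ≡ b
eqStep-sound u u _ = refl
eqStep-sound d d _ = refl

eqWord-sound : ∀ x y → eqWord x y ≡ true → x ≡ y
eqWord-sound []      []      _ = refl
eqWord-sound (a ∷ x) (b ∷ y) e with ∧-≡-true {eqStep a b} e
... | ab , xy = cong₂ _∷_ (eqStep-sound a b ab) (eqWord-sound x y xy)

eqWord-refl : ∀ x → eqWord x x ≡ true
eqWord-refl []      = refl
eqWord-refl (u ∷ x) = eqWord-refl x
eqWord-refl (d ∷ x) = eqWord-refl x

_∈ᵇ_ : Word → List Word → Bool
x ∈ᵇ ys = anyB (eqWord x) ys

anyB-∈ : ∀ {P : Word → Bool} {y} ys → y ∈ ys → P y ≡ true → anyB P ys ≡ true
anyB-∈ {P} (x ∷ ys) (here refl) e rewrite e = refl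
anyB-∈ {P} (x ∷ ys) (there p)   e with P x
... | true  = refl
... | false = anyB-∈ ys p e

anyB-none : ∀ {P : Word → Bool} ys → (∀ h → P h ≡ false) → anyB P ys ≡ false
anyB-none          []       e = refl
anyB-none {P} (x ∷ ys) e rewrite e x = anyB-none ys e

∈ᵇ-sound : ∀ x ys → x ∈ᵇ ys ≡ true → x ∈ ys
∈ᵇ-sound x (y ∷ ys) e with eqWord x y in xy
... | true  = here (eqWord-sound x y xy)
... | false = there (∈ᵇ-sound x ys e)

∈ᵇ-complete : ∀ {x} ys → x ∈ ys → x ∈ᵇ ys ≡ true
∈ᵇ-complete {x} ys p = anyB-∈ ys p (eqWord-refl x)

∉→∈ᵇ-false : ∀ {x} ys → All (x ≢_) ys → x ∈ᵇ ys ≡ false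
∉→∈ᵇ-false          []       []         = refl
∉→∈ᵇ-false {x} (y ∷ ys) (x≢y ∷ x∉) with eqWord x y in xy
... | true  = ⊥-elim (x≢y (eqWord-sound x y xy))
... | false = ∉→∈ᵇ-false ys x∉

isPrefixB-sound : ∀ w xs → isPrefixB w xs ≡ true → ∃ λ r → xs ≡ w ++ r
isPrefixB-sound []      xs       _ = xs , refl
isPrefixB-sound (a ∷ w) (b ∷ xs) e with ∧-≡-true {eqStep a b} e
... | ab , wxs with eqStep-sound a b ab | isPrefixB-sound w xs wxs
... | refl | r , refl = r , refl

drop-+ : ∀ q j (γ : Word) → drop (q + j) γ ≡ drop j (drop q γ)
drop-+ zero    j γ       = refl
drop-+ (suc q) j []      = sym (drop-[] j)
drop-+ (suc q) j (x ∷ γ) = drop-+ q j γ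

drop-pred : ∀ p (γ : Word) {y ys} → drop (p + 1) γ ≡ y ∷ ys → ∃ λ x → drop p γ ≡ x ∷ y ∷ ys
drop-pred zero    (x ∷ γ) e = x , cong (x ∷_) e
drop-pred (suc p) (x ∷ γ) e = drop-pred p γ e

drop-nonempty : ∀ n (γ : Word) {x xs} → drop n γ ≡ x ∷ xs → (n <ᵇ length γ) ≡ true
drop-nonempty zero    (a ∷ γ) e = refl
drop-nonempty (suc n) (a ∷ γ) e = drop-nonempty n γ e

∈-words : ∀ y → y ∈ words (length y)
∈-words []      = here refl
∈-words (s ∷ y) = ∈-concatMap⁺ _ (Any.map (λ { refl → extend s }) (∈-words y))
  where
  extend : ∀ s → (s ∷ y) ∈ (u ∷ y) ∷ (d ∷ y) ∷ []
  extend u = here refl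
  extend d = there (here refl)

words-length : ∀ k {y} → y ∈ words k → length y ≡ k
words-length zero    (here refl) = refl
words-length (suc k) p with find (∈-concatMap⁻ (λ w → (u ∷ w) ∷ (d ∷ w) ∷ []) {xs = words k} p)
... | w , w∈ , here refl         = cong suc (words-length k w∈)
... | w , w∈ , there (here refl) = cong suc (words-length k w∈)

∑-words-eqWord : ∀ k h (f : Word → ℕ) → length h ≡ k → ∑ (λ x → 𝟙 (eqWord x h) * f x) (words k) ≡ f h
∑-words-eqWord zero    []      f _ = trans (+-identityʳ _) (+-identityʳ _)
∑-words-eqWord (suc k) (s ∷ h) f e =
  trans (∑-concatMap (λ x → 𝟙 (eqWord x (s ∷ h)) * f x) (λ w → (u ∷ w) ∷ (d ∷ w) ∷ []) (words k))
        (trans (∑-cong (only-s s) (words k)) (∑-words-eqWord k h (f ∘ (s ∷_)) (suc-injective e)))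
  where
  only-s : ∀ s w → ∑ (λ x → 𝟙 (eqWord x (s ∷ h)) * f x) ((u ∷ w) ∷ (d ∷ w) ∷ []) ≡ 𝟙 (eqWord w h) * f (s ∷ w)
  only-s u w = +-identityʳ _
  only-s d w = +-identityʳ _

∑-words-∈ᵇ : ∀ k ys (f : Word → ℕ) → Unique ys → (∀ {y} → y ∈ ys → length y ≡ k) →
  ∑ (λ x → 𝟙 (x ∈ᵇ ys) * f x) (words k) ≡ ∑ f ys
∑-words-∈ᵇ k []       f _            _   = ∑-zero (words k)
∑-words-∈ᵇ k (y ∷ ys) f (y∉ ∷ uniq) len =
  trans (∑-cong split (words k))
  (trans (∑-+ (λ x → 𝟙 (eqWord x y) * f x) (λ x → 𝟙 (x ∈ᵇ ys) * f x) (words k))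
         (cong₂ _+_ (∑-words-eqWord k y f (len (here refl))) (∑-words-∈ᵇ k ys f uniq (len ∘ there))))
  where
  split : ∀ x → 𝟙 (x ∈ᵇ (y ∷ ys)) * f x ≡ 𝟙 (eqWord x y) * f x + 𝟙 (x ∈ᵇ ys) * f x
  split x with eqWord x y in xy
  ... | false = refl
  ... | true with eqWord-sound x y xy
  ... | refl rewrite ∉→∈ᵇ-false ys y∉ = sym (+-identityʳ _)

-- Flips

flips : Word → List Word
flips []          = []
flips (u ∷ r)     = map (u ∷_) (flips r)
flips (d ∷ [])    = []
flips (d ∷ u ∷ r) = (u ∷ d ∷ r) ∷ map (d ∷_) (flips (u ∷ r))
flips (d ∷ d ∷ r) = map (d ∷_) (flips (d ∷ r))

data Flip : Word → Word → Set where
  turn : ∀ r → Flip (d ∷ u ∷ r) (u ∷ d ∷ r)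
  skip : ∀ s {g y} → Flip g y → Flip (s ∷ g) (s ∷ y)

Flip-length : ∀ {g y} → Flip g y → length y ≡ length g
Flip-length (turn r)   = refl
Flip-length (skip s f) = cong suc (Flip-length f)

Flip→∈flips : ∀ {g y} → Flip g y → y ∈ flips g
Flip→∈flips (turn r)          = here refl
Flip→∈flips (skip u f)        = ∈-map⁺ _ (Flip→∈flips f)
Flip→∈flips (skip d (turn r)) = ∈-map⁺ _ (Flip→∈flips (turn r))
Flip→∈flips (skip d (skip u f)) = there (∈-map⁺ _ (Flip→∈flips (skip u f)))
Flip→∈flips (skip d (skip d f)) = ∈-map⁺ _ (Flip→∈flips (skip d f))

∈flips→Flip : ∀ g {y} → y ∈ flips g → Flip g y
∈flips→Flip (u ∷ r) p with ∈-map⁻ _ p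
... | _ , q , refl = skip u (∈flips→Flip r q)
∈flips→Flip (d ∷ u ∷ r) (here refl) = turn r
∈flips→Flip (d ∷ u ∷ r) (there p) with ∈-map⁻ _ p
... | _ , q , refl = skip d (∈flips→Flip (u ∷ r) q)
∈flips→Flip (d ∷ d ∷ r) p with ∈-map⁻ _ p
... | _ , q , refl = skip d (∈flips→Flip (d ∷ r) q)

flips-unique : ∀ g → Unique (flips g)
flips-unique []          = []
flips-unique (u ∷ r)     = Unique.map⁺ ∷-injectiveʳ (flips-unique r)
flips-unique (d ∷ [])    = []
flips-unique (d ∷ u ∷ r) = All.map⁺ (All.tabulate (λ _ ())) ∷ Unique.map⁺ ∷-injectiveʳ (flips-unique (u ∷ r))
flips-unique (d ∷ d ∷ r) = Unique.map⁺ ∷-injectiveʳ (flips-unique (d ∷ r))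

∑flips : (Word → ℕ) → Word → ℕ
∑flips F g = ∑ F (flips g)

chains : ℕ → Word → ℕ
chains zero    g = 1
chains (suc k) g = ∑flips (chains k) g

≤ᵇ-complete : ∀ {i j} → i ≤ j → (i ≤ℤᵇ j) ≡ true
≤ᵇ-complete i≤j = Equivalence.to T-≡ (ℤP.≤⇒≤ᵇ i≤j)

≤ᵇ-sound : ∀ {i j} → (i ≤ℤᵇ j) ≡ true → i ≤ j
≤ᵇ-sound e = ℤP.≤ᵇ⇒≤ (Equivalence.from T-≡ e)

≤ᵇ-false : ∀ {i j} → ¬ (i ≤ j) → (i ≤ℤᵇ j) ≡ false
≤ᵇ-false {i} {j} i≰j with i ≤ℤᵇ j in e
... | false = refl
... | true  = ⊥-elim (i≰j (≤ᵇ-sound e))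

-- Linear arithmetic over ℤ, reduced to a ring identity between differences.
≤-by-difference : ∀ {a b c e} k → a ≤ b → e - c ≡ (b - a) ℤ.+ ℤ.+ k → c ≤ e
≤-by-difference k a≤b eq =
  ℤP.0≤i-j⇒j≤i (subst (ℤ.+ 0 ≤_) (sym eq) (ℤP.+-mono-≤ (ℤP.i≤j⇒0≤j-i a≤b) (+≤+ z≤n)))

≤-absurd-by-difference : ∀ {a b} k → a ≤ b → (b - a) ℤ.+ ℤ.+ k ≡ -[1+ 0 ] → ⊥
≤-absurd-by-difference k a≤b eq with subst (ℤ.+ 0 ≤_) eq (ℤP.+-mono-≤ (ℤP.i≤j⇒0≤j-i a≤b) (+≤+ z≤n))
... | ()

down-up : ∀ h → stepH u (stepH d h) ≡ h
down-up = cancel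
  where
  cancel : ∀ h → (h - ℤ.+ 1) ℤ.+ ℤ.+ 1 ≡ h
  cancel = ℤSolver.solve-∀

up-down : ∀ h → stepH d (stepH u h) ≡ h
up-down = cancel
  where
  cancel : ∀ h → (h ℤ.+ ℤ.+ 1) - ℤ.+ 1 ≡ h
  cancel = ℤSolver.solve-∀

valley-peak-meet : ∀ h → stepH u (stepH d h) ≡ stepH d (stepH u h)
valley-peak-meet h = trans (down-up h) (sym (up-down h))

down≤up : ∀ h → stepH d h ≤ stepH u h
down≤up h = ℤP.+-monoʳ-≤ h -≤+

up≰down : ∀ h → ¬ (stepH u h ≤ stepH d h)
up≰down h up≤down = ≤-absurd-by-difference 1 up≤down (difference h)
  where
  difference : ∀ h → (h - ℤ.+ 1) - (h ℤ.+ ℤ.+ 1) ℤ.+ ℤ.+ 1 ≡ -[1+ 0 ]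
  difference = ℤSolver.solve-∀

≤-absurd-by-differences : ∀ {a₁ b₁ a₂ b₂ a₃ b₃} k → a₁ ≤ b₁ → a₂ ≤ b₂ → a₃ ≤ b₃ →
  (b₁ - a₁) ℤ.+ (b₂ - a₂) ℤ.+ (b₃ - a₃) ℤ.+ ℤ.+ k ≡ -[1+ 0 ] → ⊥
≤-absurd-by-differences k p₁ p₂ p₃ eq
  with subst (ℤ.+ 0 ≤_) eq (ℤP.+-mono-≤ (ℤP.+-mono-≤ (ℤP.+-mono-≤ (ℤP.i≤j⇒0≤j-i p₁) (ℤP.i≤j⇒0≤j-i p₂))
                                                    (ℤP.i≤j⇒0≤j-i p₃)) (+≤+ z≤n))
... | ()

gap-up : ∀ t hg hx → hg ℤ.+ ℤ.+ 2 ≤ hx → stepH u hg ≤ stepH t hx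
gap-up u hg hx gap = ≤-by-difference 2 gap (difference hg hx)
  where
  difference : ∀ hg hx → (hx ℤ.+ ℤ.+ 1) - (hg ℤ.+ ℤ.+ 1) ≡ (hx - (hg ℤ.+ ℤ.+ 2)) ℤ.+ ℤ.+ 2
  difference = ℤSolver.solve-∀
gap-up d hg hx gap = ≤-by-difference 0 gap (difference hg hx)
  where
  difference : ∀ hg hx → (hx - ℤ.+ 1) - (hg ℤ.+ ℤ.+ 1) ≡ (hx - (hg ℤ.+ ℤ.+ 2)) ℤ.+ ℤ.+ 0
  difference = ℤSolver.solve-∀

gap-after-down : ∀ t hg hx → hg ℤ.+ ℤ.+ 2 ≤ hx → stepH d hg ℤ.+ ℤ.+ 2 ≤ stepH t hx
gap-after-down u hg hx gap = ≤-by-difference 2 gap (difference hg hx)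
  where
  difference : ∀ hg hx → (hx ℤ.+ ℤ.+ 1) - ((hg - ℤ.+ 1) ℤ.+ ℤ.+ 2) ≡ (hx - (hg ℤ.+ ℤ.+ 2)) ℤ.+ ℤ.+ 2
  difference = ℤSolver.solve-∀
gap-after-down d hg hx gap = ≤-by-difference 0 gap (difference hg hx)
  where
  difference : ∀ hg hx → (hx - ℤ.+ 1) - ((hg - ℤ.+ 1) ℤ.+ ℤ.+ 2) ≡ (hx - (hg ℤ.+ ℤ.+ 2)) ℤ.+ ℤ.+ 0
  difference = ℤSolver.solve-∀

-- The covering relation of 𝒟ₙ

below : ℤ → ℤ → Word → Word → Bool
below a b g x = pointwiseLe (heightsFrom a g) (heightsFrom b x)

below-cons-refl : ∀ h {b} → b ≡ true → ((h ≤ℤᵇ h) ∧ b) ≡ true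
below-cons-refl h e rewrite ≤ᵇ-complete (ℤP.≤-refl {h}) = e

below-cons-refl-false : ∀ h {b} → b ≡ false → ((h ≤ℤᵇ h) ∧ b) ≡ false
below-cons-refl-false h e rewrite ≤ᵇ-complete (ℤP.≤-refl {h}) = e

below-refl : ∀ h g → below h h g g ≡ true
below-refl h []      = refl
below-refl h (s ∷ g) = below-cons-refl (stepH s h) (below-refl (stepH s h) g)

below-start-congˡ : ∀ {a a′ b : ℤ} (w x : Word) → a ≡ a′ →
  ((a ≤ℤᵇ b) ∧ below a b w x) ≡ ((a′ ≤ℤᵇ b) ∧ below a′ b w x)
below-start-congˡ w x refl = refl

below-start-congʳ : ∀ {a b b′ : ℤ} (w x : Word) → b ≡ b′ →
  ((a ≤ℤᵇ b) ∧ below a b w x) ≡ ((a ≤ℤᵇ b′) ∧ below a b′ w x)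
below-start-congʳ w x refl = refl

same-step : ∀ h s t → (stepH s h ≤ℤᵇ stepH t h) ≡ true → (stepH t h ≤ℤᵇ stepH s h) ≡ true → s ≡ t
same-step h u u _  _  = refl
same-step h d d _  _  = refl
same-step h u d e₁ _  = ⊥-elim (up≰down h (≤ᵇ-sound e₁))
same-step h d u _  e₂ = ⊥-elim (up≰down h (≤ᵇ-sound e₂))

below-antisym : ∀ h z w → below h h z w ≡ true → below h h w z ≡ true → z ≡ w
below-antisym h []      []      _  _  = refl
below-antisym h (s ∷ z) (t ∷ w) e₁ e₂
  with ∧-≡-true {stepH s h ≤ℤᵇ stepH t h} e₁ | ∧-≡-true {stepH t h ≤ℤᵇ stepH s h} e₂
... | s≤t , z≤w | t≤s , w≤z with same-step h s t s≤t t≤s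
... | refl = cong (s ∷_) (below-antisym (stepH s h) z w z≤w w≤z)

Flip-below : ∀ h {g y} → Flip g y → below h h g y ≡ true
Flip-below h (turn r) rewrite ≤ᵇ-complete (down≤up h) =
  trans (sym (below-start-congʳ r r (valley-peak-meet h))) (below-refl (stepH d h) (u ∷ r))
Flip-below h (skip s f) = below-cons-refl (stepH s h) (Flip-below (stepH s h) f)

Flip-not-above : ∀ h {g y} → Flip g y → below h h y g ≡ false
Flip-not-above h (turn r)   rewrite ≤ᵇ-false (up≰down h) = refl
Flip-not-above h (skip s f) = below-cons-refl-false (stepH s h) (Flip-not-above (stepH s h) f)

Flip-Dyck : ∀ h {g y} → Flip g y → isDyckFrom h g ≡ true → isDyckFrom h y ≡ true
Flip-Dyck h (turn r) e with ∧-≡-true {ℤ.+ 0 ≤ℤᵇ stepH d h} e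
... | 0≤down , rest = ∧-intro (≤ᵇ-complete {ℤ.+ 0} (ℤP.≤-trans (≤ᵇ-sound 0≤down) (down≤up h)))
                              (trans (cong (λ h′ → (ℤ.+ 0 ≤ℤᵇ h′) ∧ isDyckFrom h′ r) (sym (valley-peak-meet h))) rest)
Flip-Dyck h (skip s f) e with ∧-≡-true {ℤ.+ 0 ≤ℤᵇ stepH s h} e
... | 0≤h′ , rest = ∧-intro 0≤h′ (Flip-Dyck (stepH s h) f rest)

Flip-interval : ∀ h {g y} z → Flip g y → below h h g z ≡ true → below h h z y ≡ true → (z ≡ g) ⊎ (z ≡ y)
Flip-interval h (t ∷ z) (skip s f) e₁ e₂
  with ∧-≡-true {stepH s h ≤ℤᵇ stepH t h} e₁ | ∧-≡-true {stepH t h ≤ℤᵇ stepH s h} e₂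
... | s≤t , g≤z | t≤s , z≤y with same-step h s t s≤t t≤s
... | refl with Flip-interval (stepH s h) z f g≤z z≤y
... | inj₁ z≡g = inj₁ (cong (s ∷_) z≡g)
... | inj₂ z≡y = inj₂ (cong (s ∷_) z≡y)
Flip-interval h (t ∷ []) (turn r) e₁ e₂ with ∧-≡-true {stepH d h ≤ℤᵇ stepH t h} e₁
... | _ , ()
Flip-interval h (t ∷ t′ ∷ z) (turn r) e₁ e₂
  with ∧-≡-true {stepH d h ≤ℤᵇ stepH t h} e₁ | ∧-≡-true {stepH t h ≤ℤᵇ stepH u h} e₂
... | _ , e₁′ | _ , e₂′
  with ∧-≡-true {stepH u (stepH d h) ≤ℤᵇ stepH t′ (stepH t h)} e₁′
     | ∧-≡-true {stepH t′ (stepH t h) ≤ℤᵇ stepH d (stepH u h)} e₂′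
Flip-interval h (d ∷ u ∷ z) (turn r) e₁ e₂ | _ , _ | _ , _ | _ , r≤z | _ , z≤r =
  inj₁ (cong (λ w → d ∷ u ∷ w) (below-antisym (stepH u (stepH d h)) z r
    (subst (λ b → below (stepH u (stepH d h)) b z r ≡ true) (sym (valley-peak-meet h)) z≤r) r≤z))
Flip-interval h (d ∷ d ∷ z) (turn r) e₁ e₂ | _ , _ | _ , _ | up≤down , _ | _ , _ =
  ⊥-elim (up≰down (stepH d h) (≤ᵇ-sound up≤down))
Flip-interval h (u ∷ d ∷ z) (turn r) e₁ e₂ | _ , _ | _ , _ | _ , r≤z | _ , z≤r =
  inj₂ (cong (λ w → u ∷ d ∷ w) (below-antisym (stepH d (stepH u h)) z r z≤r
    (subst (λ a → below a (stepH d (stepH u h)) r z ≡ true) (valley-peak-meet h) r≤z)))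
Flip-interval h (u ∷ u ∷ z) (turn r) e₁ e₂ | _ , _ | _ , _ | _ , _ | up≤down , _ =
  ⊥-elim (up≰down (stepH u h) (≤ᵇ-sound up≤down))

below-turn-first : ∀ a a′ b (w x : Word) → stepH u a ≡ stepH d a′ → below a b (u ∷ w) x ≡ below a′ b (d ∷ w) x
below-turn-first a a′ b w []      eq = refl
below-turn-first a a′ b w (t ∷ x) eq = below-start-congˡ w x eq

flip-below-across-gap : ∀ hg hx r x → hg ℤ.+ ℤ.+ 2 ≤ hx → isDyckFrom hg (d ∷ r) ≡ true → isDyckFrom hx x ≡ true →
  below hg hx (d ∷ r) x ≡ true → ∃ λ y → Flip (d ∷ r) y × (below hg hx y x ≡ true)
flip-below-across-gap hg hx [] (t ∷ t′ ∷ x) gap dg dx e with ∧-≡-true {stepH d hg ≤ℤᵇ stepH t hx} e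
... | _ , ()
flip-below-across-gap hg hx [] (t ∷ []) gap dg dx e
  with ∧-≡-true {ℤ.+ 0 ≤ℤᵇ stepH d hg} dg | ∧-≡-true {ℤ.+ 0 ≤ℤᵇ stepH t hx} dx
... | 0≤g , _ | _ , x-ends with ∧-≡-true {stepH t hx ≤ℤᵇ ℤ.+ 0} x-ends
... | x≤0 , _ = ⊥-elim (ends-too-high t (≤ᵇ-sound 0≤g) (≤ᵇ-sound x≤0))
  where
  ends-too-high : ∀ t → ℤ.+ 0 ≤ stepH d hg → stepH t hx ≤ ℤ.+ 0 → ⊥
  ends-too-high u p₁ p₃ = ≤-absurd-by-differences 3 p₁ gap p₃ (difference hg hx)
    where
    difference : ∀ hg hx →
      ((hg - ℤ.+ 1) - ℤ.+ 0) ℤ.+ (hx - (hg ℤ.+ ℤ.+ 2)) ℤ.+ (ℤ.+ 0 - (hx ℤ.+ ℤ.+ 1)) ℤ.+ ℤ.+ 3 ≡ -[1+ 0 ]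
    difference = ℤSolver.solve-∀
  ends-too-high d p₁ p₃ = ≤-absurd-by-differences 1 p₁ gap p₃ (difference hg hx)
    where
    difference : ∀ hg hx →
      ((hg - ℤ.+ 1) - ℤ.+ 0) ℤ.+ (hx - (hg ℤ.+ ℤ.+ 2)) ℤ.+ (ℤ.+ 0 - (hx - ℤ.+ 1)) ℤ.+ ℤ.+ 1 ≡ -[1+ 0 ]
    difference = ℤSolver.solve-∀
flip-below-across-gap hg hx (u ∷ r) (t ∷ x) gap dg dx e with ∧-≡-true {stepH d hg ≤ℤᵇ stepH t hx} e
... | _ , rest = (u ∷ d ∷ r) , turn r ,
  ∧-intro (≤ᵇ-complete (gap-up t hg hx gap))
          (trans (sym (below-turn-first (stepH d hg) (stepH u hg) (stepH t hx) r x (valley-peak-meet hg))) rest)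
flip-below-across-gap hg hx (d ∷ r) (t ∷ x) gap dg dx e
  with ∧-≡-true {stepH d hg ≤ℤᵇ stepH t hx} e | ∧-≡-true {ℤ.+ 0 ≤ℤᵇ stepH d hg} dg
     | ∧-≡-true {ℤ.+ 0 ≤ℤᵇ stepH t hx} dx
... | first , rest | _ , dg′ | _ , dx′
  with flip-below-across-gap (stepH d hg) (stepH t hx) r x (gap-after-down t hg hx gap) dg′ dx′ rest
... | y , f , y≤x = (d ∷ y) , skip d f , ∧-intro first y≤x

flip-toward : ∀ h g x → isDyckFrom h g ≡ true → isDyckFrom h x ≡ true → below h h g x ≡ true → ¬ (g ≡ x) →
  ∃ λ y → Flip g y × (below h h y x ≡ true)
flip-toward h [] [] dg dx e g≢x = ⊥-elim (g≢x refl)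
flip-toward h (s ∷ g) (t ∷ x) dg dx e g≢x
  with ∧-≡-true {stepH s h ≤ℤᵇ stepH t h} e | ∧-≡-true {ℤ.+ 0 ≤ℤᵇ stepH s h} dg
     | ∧-≡-true {ℤ.+ 0 ≤ℤᵇ stepH t h} dx
flip-toward h (u ∷ g) (u ∷ x) dg dx e g≢x | _ , rest | _ , dg′ | _ , dx′
  with flip-toward (stepH u h) g x dg′ dx′ rest (g≢x ∘ cong (u ∷_))
... | y , f , y≤x = (u ∷ y) , skip u f , below-cons-refl (stepH u h) y≤x
flip-toward h (d ∷ g) (d ∷ x) dg dx e g≢x | _ , rest | _ , dg′ | _ , dx′
  with flip-toward (stepH d h) g x dg′ dx′ rest (g≢x ∘ cong (d ∷_))
... | y , f , y≤x = (d ∷ y) , skip d f , below-cons-refl (stepH d h) y≤x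
flip-toward h (u ∷ g) (d ∷ x) dg dx e g≢x | first , _ | _ , _ | _ , _ = ⊥-elim (up≰down h (≤ᵇ-sound first))
flip-toward h (d ∷ []) (u ∷ (t ∷ x)) dg dx e g≢x | _ , () | _ , _ | _ , _
flip-toward h (d ∷ []) (u ∷ []) dg dx e g≢x | _ , _ | 0≤down , _ | _ , x-ends
  with ∧-≡-true {stepH u h ≤ℤᵇ ℤ.+ 0} x-ends
... | up≤0 , _ = ⊥-elim (up≰down h (ℤP.≤-trans (≤ᵇ-sound up≤0) (≤ᵇ-sound 0≤down)))
flip-toward h (d ∷ u ∷ r) (u ∷ x) dg dx e g≢x | _ , rest | _ , _ | _ , _ =
  (u ∷ d ∷ r) , turn r ,
  below-cons-refl (stepH u h) (trans (sym (below-turn-first (stepH d h) (stepH u h) (stepH u h) r x (valley-peak-meet h))) rest)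
flip-toward h (d ∷ d ∷ r) (u ∷ x) dg dx e g≢x | first , rest | _ , dg′ | _ , dx′
  with flip-below-across-gap (stepH d h) (stepH u h) r x gap dg′ dx′ rest
  where
  gap : stepH d h ℤ.+ ℤ.+ 2 ≤ stepH u h
  gap = ≤-by-difference {ℤ.+ 0} {ℤ.+ 0} 0 ℤP.≤-refl (difference h)
    where
    difference : ∀ h → (h ℤ.+ ℤ.+ 1) - ((h - ℤ.+ 1) ℤ.+ ℤ.+ 2) ≡ (ℤ.+ 0 - ℤ.+ 0) ℤ.+ ℤ.+ 0
    difference = ℤSolver.solve-∀
... | y , f , y≤x = (d ∷ y) , skip d f , ∧-intro first y≤x

Flip→ltB : ∀ {g y} → Flip g y → ltB g y ≡ true
Flip→ltB f = ∧-intro (Flip-below (ℤ.+ 0) f) (cong not (Flip-not-above (ℤ.+ 0) f))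

ltB-irrefl : ∀ g → ltB g g ≡ false
ltB-irrefl g rewrite below-refl (ℤ.+ 0) g = refl

covers≡∈ᵇflips : ∀ n g → isDyck g ≡ true → length g ≡ 2 * n →
  ∀ x → (isDyck x ∧ coversB n g x) ≡ x ∈ᵇ flips g
covers≡∈ᵇflips n g dg lg x with x ∈ᵇ flips g in x∈ᵇ
... | true = ∧-intro (Flip-Dyck (ℤ.+ 0) f dg) (∧-intro (Flip→ltB f) (cong not (anyB-none (Dyck n) nothing-between)))
  where
  f : Flip g x
  f = ∈flips→Flip g (∈ᵇ-sound x (flips g) x∈ᵇ)
  nothing-between : ∀ h → (ltB g h ∧ ltB h x) ≡ false
  nothing-between h with ltB g h in g<h | ltB h x in h<x
  ... | false | _     = refl
  ... | true  | false = refl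
  ... | true  | true  with ∧-≡-true {leqB g h} g<h | ∧-≡-true {leqB h x} h<x
  ... | g≤h , h≰g | h≤x , x≰h with Flip-interval (ℤ.+ 0) h f g≤h h≤x
  ... | inj₁ refl = ⊥-elim (true≢false (below-refl (ℤ.+ 0) g) (not-≡-true h≰g))
  ... | inj₂ refl = ⊥-elim (true≢false (below-refl (ℤ.+ 0) x) (not-≡-true x≰h))
... | false with isDyck x in dx
...   | false = refl
...   | true with ltB g x in g<x
...     | false = refl
...     | true with flip-toward (ℤ.+ 0) g x dg dx (proj₁ (∧-≡-true {leqB g x} g<x)) g≢x
  where
  g≢x : ¬ (g ≡ x)
  g≢x refl = true≢false g<x (ltB-irrefl g)
...     | y , f , y≤x = cong not (anyB-∈ (Dyck n) y∈Dyck (∧-intro (Flip→ltB f) (∧-intro y≤x (cong not x≰y))))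
  where
  y∈Dyck : y ∈ Dyck n
  y∈Dyck = ∈-filterB⁺ (words (2 * n)) (subst (λ k → y ∈ words k) (trans (Flip-length f) lg) (∈-words y))
                      (Flip-Dyck (ℤ.+ 0) f dg)
  x≰y : leqB x y ≡ false
  x≰y with leqB x y in x≤y
  ... | false = refl
  ... | true with below-antisym (ℤ.+ 0) x y x≤y y≤x
  ... | refl = ⊥-elim (true≢false (∈ᵇ-complete (flips g) (Flip→∈flips f)) x∈ᵇ)

∑-covers≡∑flips : ∀ n g → isDyck g ≡ true → length g ≡ 2 * n → ∀ (f : Word → ℕ) →
  ∑ f (filterB (coversB n g) (Dyck n)) ≡ ∑ f (flips g)
∑-covers≡∑flips n g dg lg f =
  trans (∑-filterB (coversB n g) f (Dyck n))
  (trans (∑-filterB isDyck (λ x → 𝟙 (coversB n g x) * f x) (words (2 * n)))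
  (trans (∑-cong indicator (words (2 * n)))
         (∑-words-∈ᵇ (2 * n) (flips g) f (flips-unique g) (λ p → trans (Flip-length (∈flips→Flip g p)) lg))))
  where
  indicator : ∀ x → 𝟙 (isDyck x) * (𝟙 (coversB n g x) * f x) ≡ 𝟙 (x ∈ᵇ flips g) * f x
  indicator x = trans (sym (*-assoc (𝟙 (isDyck x)) (𝟙 (coversB n g x)) (f x)))
    (cong (_* f x) (trans (sym (𝟙-∧ (isDyck x) (coversB n g x))) (cong 𝟙 (covers≡∈ᵇflips n g dg lg x))))

coverChains : ℕ → ℕ → Word → ℕ
coverChains n zero    g = 1
coverChains n (suc k) g = ∑ (coverChains n k) (filterB (coversB n g) (Dyck n))

InDyck : ℕ → Word → Set
InDyck n x = (isDyck x ≡ true) × (length x ≡ 2 * n)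

∈Dyck→InDyck : ∀ n {x} → x ∈ Dyck n → InDyck n x
∈Dyck→InDyck n p with ∈-filterB⁻ (words (2 * n)) p
... | q , dx = dx , words-length (2 * n) q

coverChains≡chains : ∀ n k g → InDyck n g → coverChains n k g ≡ chains k g
coverChains≡chains n zero    g _           = refl
coverChains≡chains n (suc k) g (dg , lg) =
  trans (∑-covers≡∑flips n g dg lg (coverChains n k))
        (∑-cong-∈ (flips g) λ p → coverChains≡chains n k _ (Flip-Dyck (ℤ.+ 0) (∈flips→Flip g p) dg ,
                                                           trans (Flip-length (∈flips→Flip g p)) lg))

sc3≡∑coverChains : ∀ n → sc3 n ≡ ∑ (coverChains n 3) (Dyck n)
sc3≡∑coverChains n = ∑-cong (λ g₀ → ∑-cong (λ g₁ → ∑-cong (λ g₂ →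
  length≡∑1 (filterB (coversB n g₂) (Dyck n))) (filterB (coversB n g₁) (Dyck n))) (filterB (coversB n g₀) (Dyck n)))
  (Dyck n)

-- Flip chains in terms of factor counts

factorCount : Word → Word → ℕ
factorCount w []      = 0
factorCount w (x ∷ γ) = 𝟙 (isPrefixB w (x ∷ γ)) + factorCount w γ

du ddu duu dddu duuu dduu dudu : Word
du   = d ∷ u ∷ []
ddu  = d ∷ d ∷ u ∷ []
duu  = d ∷ u ∷ u ∷ []
dddu = d ∷ d ∷ d ∷ u ∷ []
duuu = d ∷ u ∷ u ∷ u ∷ []
dduu = d ∷ d ∷ u ∷ u ∷ []
dudu = d ∷ u ∷ d ∷ u ∷ []

#du #ddu #duu #dddu #duuu #dduu #dudu : Word → ℕ
#du   = factorCount du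
#ddu  = factorCount ddu
#duu  = factorCount duu
#dddu = factorCount dddu
#duuu = factorCount duuu
#dduu = factorCount dduu
#dudu = factorCount dudu

startsWith : Word → Word → ℕ
startsWith w γ = 𝟙 (isPrefixB w γ)

startsU : Word → ℕ
startsU = startsWith (u ∷ [])

∑flips-u : ∀ F r → ∑flips F (u ∷ r) ≡ ∑flips (F ∘ (u ∷_)) r
∑flips-u F r = ∑-map F (u ∷_) (flips r)

∑flips-du : ∀ F r → ∑flips F (d ∷ u ∷ r) ≡ F (u ∷ d ∷ r) + ∑flips (λ h → F (d ∷ u ∷ h)) r
∑flips-du F r = cong (F (u ∷ d ∷ r) +_)
  (trans (∑-map F (d ∷_) (flips (u ∷ r))) (∑-map (F ∘ (d ∷_)) (u ∷_) (flips r)))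

∑flips-dd : ∀ F r → ∑flips F (d ∷ d ∷ r) ≡ ∑flips (F ∘ (d ∷_)) (d ∷ r)
∑flips-dd F r = ∑-map F (d ∷_) (flips (d ∷ r))

∑flips-zero : ∀ g → ∑flips (λ _ → 0) g ≡ 0
∑flips-zero g = ∑-zero (flips g)

chains-1 : ∀ g → chains 1 g ≡ #du g
chains-1 []          = refl
chains-1 (u ∷ r)     = trans (∑flips-u (λ _ → 1) r) (chains-1 r)
chains-1 (d ∷ [])    = refl
chains-1 (d ∷ u ∷ r) = trans (∑flips-du (λ _ → 1) r) (cong suc (chains-1 r))
chains-1 (d ∷ d ∷ r) = trans (∑flips-dd (λ _ → 1) r) (chains-1 (d ∷ r))

∑flips-startsU-d : ∀ r → ∑flips startsU (d ∷ r) ≡ startsU r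
∑flips-startsU-d []      = refl
∑flips-startsU-d (u ∷ r) = trans (∑flips-du startsU r) (cong suc (∑flips-zero r))
∑flips-startsU-d (d ∷ r) = trans (∑flips-dd startsU r) (∑flips-zero (d ∷ r))

∑flips-startsU : ∀ r → ∑flips startsU r ≡ startsU r * #du r + startsWith du r
∑flips-startsU []      = refl
∑flips-startsU (u ∷ r) =
  trans (∑flips-u startsU r) (trans (chains-1 r) (sym (trans (+-identityʳ (1 * #du r)) (*-identityˡ (#du r)))))
∑flips-startsU (d ∷ r) = trans (∑flips-startsU-d r) (startsU-d r)
  where
  startsU-d : ∀ r → startsU r ≡ startsU (d ∷ r) * #du (d ∷ r) + startsWith du (d ∷ r)
  startsU-d []      = refl
  startsU-d (u ∷ r) = refl
  startsU-d (d ∷ r) = refl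

∑flips-#du : ∀ g → ∑flips #du g + #du g ≡ #du g * #du g + #ddu g + #duu g
∑flips-#du []          = refl
∑flips-#du (u ∷ r)     = trans (cong (_+ #du r) (∑flips-u #du r)) (∑flips-#du r)
∑flips-#du (d ∷ [])    = refl
∑flips-#du (d ∷ u ∷ r) = trans (cong (_+ suc (#du r)) unfold) (closing (∑flips-#du r))
  where
  unfold : ∑flips #du (d ∷ u ∷ r) ≡ startsU r + #du r + (#du r + ∑flips #du r)
  unfold = trans (∑flips-du #du r)
    (cong (startsU r + #du r +_) (trans (∑-+ (λ _ → 1) #du (flips r)) (cong (_+ ∑flips #du r) (chains-1 r))))
  closing : ∀ {s v x a b} → x + v ≡ v * v + a + b →
            s + v + (v + x) + suc v ≡ suc v * suc v + a + (s + b)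
  closing {s} {v} {x} {a} {b} ih = +-cancelʳ-≡-via (shuffle s v x a b) ih
    where
    shuffle : ∀ s v x a b → s + v + (v + x) + suc v + (v * v + a + b) ≡ suc v * suc v + a + (s + b) + (x + v)
    shuffle = solve-∀
∑flips-#du (d ∷ d ∷ r) = trans (cong (_+ #du (d ∷ r)) unfold)
  (closing (startsU r) (∑flips-#du (d ∷ r)))
  where
  unfold : ∑flips #du (d ∷ d ∷ r) ≡ startsU r + ∑flips #du (d ∷ r)
  unfold = trans (∑flips-dd #du r)
    (trans (∑-+ startsU #du (flips (d ∷ r))) (cong (_+ ∑flips #du (d ∷ r)) (∑flips-startsU-d r)))
  closing : ∀ s {v x a b} → x + v ≡ v * v + a + b → s + x + v ≡ v * v + (s + a) + b
  closing s {v} {x} {a} {b} ih = +-cancelʳ-≡-via (shuffle s v x a b) ih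
    where
    shuffle : ∀ s v x a b → s + x + v + (v * v + a + b) ≡ v * v + (s + a) + b + (x + v)
    shuffle = solve-∀

chains-2 : ∀ g → chains 2 g + #du g ≡ #du g * #du g + #ddu g + #duu g
chains-2 g = trans (cong (_+ #du g) (∑-cong chains-1 (flips g))) (∑flips-#du g)

#du²+#ddu+#duu : Word → ℕ
#du²+#ddu+#duu h = #du h * #du h + #ddu h + #duu h

QuadraticFlipSum : Word → Set
QuadraticFlipSum g =
  ∑flips #du²+#ddu+#duu g + 2 * (#du g * #du g) + 2 * (#ddu g + #duu g)
  ≡ #du g * #du g * #du g + #du g + 3 * #du g * (#ddu g + #duu g)
    + 2 * #dduu g + #dddu g + #duuu g + 2 * #dudu g

quadraticFlipSum-du : ∀ r → QuadraticFlipSum r → QuadraticFlipSum (d ∷ u ∷ r)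
quadraticFlipSum-du r ih =
  trans (cong (λ z → z + 2 * (suc (#du r) * suc (#du r)) + 2 * (#ddu r + (startsU r + #duu r))) unfold)
        (closing (startsU r) (startsWith du r) (startsWith (u ∷ u ∷ []) r) (#du r) (#ddu r) (#duu r)
                 (#dddu r) (#duuu r) (#dduu r) (#dudu r) (∑flips #du r) (∑flips #du²+#ddu+#duu r)
                 (∑flips-#du r) ih (𝟙-idem (isPrefixB (u ∷ []) r)))
  where
  after-du : ∀ v a b s → suc v * suc v + a + (s + b) ≡ v * v + a + b + (2 * v + (1 + s))
  after-du = solve-∀
  unfold : ∑flips #du²+#ddu+#duu (d ∷ u ∷ r)
         ≡ #du²+#ddu+#duu (u ∷ d ∷ r)
           + (∑flips #du²+#ddu+#duu r + (2 * ∑flips #du r + (#du r + (startsU r * #du r + startsWith du r))))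
  unfold = trans (∑flips-du #du²+#ddu+#duu r) (cong (#du²+#ddu+#duu (u ∷ d ∷ r) +_)
    (trans (∑-cong (λ h → after-du (#du h) (#ddu h) (#duu h) (startsU h)) (flips r))
    (trans (∑-+ #du²+#ddu+#duu (λ h → 2 * #du h + (1 + startsU h)) (flips r))
    (cong (∑flips #du²+#ddu+#duu r +_) (trans (∑-+ (λ h → 2 * #du h) (λ h → 1 + startsU h) (flips r))
      (cong₂ _+_ (∑-*ˡ 2 #du (flips r))
                 (trans (∑-+ (λ _ → 1) startsU (flips r)) (cong₂ _+_ (chains-1 r) (∑flips-startsU r)))))))))
  shuffle : ∀ s t w v a b c1 c2 c3 c4 x q →
      (s + v) * (s + v) + (t + a) + (w + b) + (q + (2 * x + (v + (s * v + t))))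
        + 2 * (suc v * suc v) + 2 * (a + (s + b))
      + (2 * (v * v + a + b) + (v * v * v + v + 3 * v * (a + b) + 2 * c3 + c1 + c2 + 2 * c4) + s)
      ≡ suc v * suc v * suc v + suc v + 3 * suc v * (a + (s + b)) + 2 * c3 + c1 + (w + c2) + 2 * (t + c4)
      + (2 * (x + v) + (q + 2 * (v * v) + 2 * (a + b)) + s * s)
  shuffle = solve-∀
  closing : ∀ s t w v a b c1 c2 c3 c4 x q →
      x + v ≡ v * v + a + b →
      q + 2 * (v * v) + 2 * (a + b) ≡ v * v * v + v + 3 * v * (a + b) + 2 * c3 + c1 + c2 + 2 * c4 →
      s * s ≡ s →
      (s + v) * (s + v) + (t + a) + (w + b) + (q + (2 * x + (v + (s * v + t))))
        + 2 * (suc v * suc v) + 2 * (a + (s + b))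
      ≡ suc v * suc v * suc v + suc v + 3 * suc v * (a + (s + b)) + 2 * c3 + c1 + (w + c2) + 2 * (t + c4)
  closing s t w v a b c1 c2 c3 c4 x q ih₁ ih₂ s²≡s =
    +-cancelʳ-≡-via (shuffle s t w v a b c1 c2 c3 c4 x q) (cong₂ _+_ (cong₂ _+_ (cong (2 *_) ih₁) ih₂) s²≡s)

quadraticFlipSum-ddu : ∀ r → QuadraticFlipSum r → QuadraticFlipSum (d ∷ d ∷ u ∷ r)
quadraticFlipSum-ddu r ih =
  trans (cong (λ z → z + 2 * (suc (#du r) * suc (#du r)) + 2 * (suc (#ddu r) + (startsU r + #duu r))) unfold)
        (closing (startsU r) (startsWith du r) (startsWith (u ∷ u ∷ []) r) (#du r) (#ddu r) (#duu r)
                 (#dddu r) (#duuu r) (#dduu r) (#dudu r) (∑flips #du r) (∑flips #du²+#ddu+#duu r)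
                 (∑flips-#du r) ih (𝟙-idem (isPrefixB (u ∷ []) r)))
  where
  after-ddu : ∀ v a b s → suc v * suc v + suc a + (s + b) ≡ v * v + a + b + (2 * v + (2 + s))
  after-ddu = solve-∀
  unfold : ∑flips #du²+#ddu+#duu (d ∷ d ∷ u ∷ r)
         ≡ #du²+#ddu+#duu (d ∷ u ∷ d ∷ r)
           + (∑flips #du²+#ddu+#duu r + (2 * ∑flips #du r + (2 * #du r + (startsU r * #du r + startsWith du r))))
  unfold = trans (∑flips-dd #du²+#ddu+#duu (u ∷ r))
    (trans (∑flips-du (#du²+#ddu+#duu ∘ (d ∷_)) r) (cong (#du²+#ddu+#duu (d ∷ u ∷ d ∷ r) +_)
    (trans (∑-cong (λ h → after-ddu (#du h) (#ddu h) (#duu h) (startsU h)) (flips r))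
    (trans (∑-+ #du²+#ddu+#duu (λ h → 2 * #du h + (2 + startsU h)) (flips r))
    (cong (∑flips #du²+#ddu+#duu r +_) (trans (∑-+ (λ h → 2 * #du h) (λ h → 2 + startsU h) (flips r))
      (cong₂ _+_ (∑-*ˡ 2 #du (flips r))
        (trans (∑-+ (λ _ → 2) startsU (flips r))
          (cong₂ _+_ (trans (∑-*ˡ 2 (λ _ → 1) (flips r)) (cong (2 *_) (chains-1 r))) (∑flips-startsU r))))))))))
  shuffle : ∀ s t w v a b c1 c2 c3 c4 x q →
      suc (s + v) * suc (s + v) + (t + a) + (w + b) + (q + (2 * x + (2 * v + (s * v + t))))
        + 2 * (suc v * suc v) + 2 * (suc a + (s + b))
      + (2 * (v * v + a + b) + (v * v * v + v + 3 * v * (a + b) + 2 * c3 + c1 + c2 + 2 * c4) + s)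
      ≡ suc v * suc v * suc v + suc v + 3 * suc v * (suc a + (s + b)) + 2 * (s + c3) + c1 + (w + c2) + 2 * (t + c4)
      + (2 * (x + v) + (q + 2 * (v * v) + 2 * (a + b)) + s * s)
  shuffle = solve-∀
  closing : ∀ s t w v a b c1 c2 c3 c4 x q →
      x + v ≡ v * v + a + b →
      q + 2 * (v * v) + 2 * (a + b) ≡ v * v * v + v + 3 * v * (a + b) + 2 * c3 + c1 + c2 + 2 * c4 →
      s * s ≡ s →
      suc (s + v) * suc (s + v) + (t + a) + (w + b) + (q + (2 * x + (2 * v + (s * v + t))))
        + 2 * (suc v * suc v) + 2 * (suc a + (s + b))
      ≡ suc v * suc v * suc v + suc v + 3 * suc v * (suc a + (s + b)) + 2 * (s + c3) + c1 + (w + c2) + 2 * (t + c4)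
  closing s t w v a b c1 c2 c3 c4 x q ih₁ ih₂ s²≡s =
    +-cancelʳ-≡-via (shuffle s t w v a b c1 c2 c3 c4 x q) (cong₂ _+_ (cong₂ _+_ (cong (2 *_) ih₁) ih₂) s²≡s)

quadraticFlipSum-ddd : ∀ r → QuadraticFlipSum (d ∷ d ∷ r) → QuadraticFlipSum (d ∷ d ∷ d ∷ r)
quadraticFlipSum-ddd r ih =
  trans (cong (λ z → z + 2 * (#du g * #du g) + 2 * (#ddu g + #duu g)) unfold)
        (closing (∑flips #du²+#ddu+#duu g) (startsU r) (#du g) (#ddu g) (#duu g)
                 (#dddu g) (#duuu g) (#dduu g) (#dudu g) ih)
  where
  g : Word
  g = d ∷ d ∷ r
  after-d : ∀ v s a b → v * v + (s + a) + b ≡ v * v + a + b + s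
  after-d = solve-∀
  unfold : ∑flips #du²+#ddu+#duu (d ∷ d ∷ d ∷ r) ≡ ∑flips #du²+#ddu+#duu g + startsU r
  unfold = trans (∑flips-dd #du²+#ddu+#duu (d ∷ r)) (trans (∑flips-dd (#du²+#ddu+#duu ∘ (d ∷_)) r)
    (trans (∑-cong (λ h → after-d (#du (d ∷ h)) (startsU h) (#ddu (d ∷ h)) (#duu (d ∷ h))) (flips (d ∷ r)))
    (trans (∑-+ (#du²+#ddu+#duu ∘ (d ∷_)) startsU (flips (d ∷ r)))
    (cong₂ _+_ (sym (∑flips-dd #du²+#ddu+#duu r)) (∑flips-startsU-d r)))))
  shuffle : ∀ q s v a b c1 c2 c3 c4 →
      q + s + 2 * (v * v) + 2 * (a + b) + (v * v * v + v + 3 * v * (a + b) + 2 * c3 + c1 + c2 + 2 * c4)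
      ≡ v * v * v + v + 3 * v * (a + b) + 2 * c3 + (s + c1) + c2 + 2 * c4 + (q + 2 * (v * v) + 2 * (a + b))
  shuffle = solve-∀
  closing : ∀ q s v a b c1 c2 c3 c4 →
      q + 2 * (v * v) + 2 * (a + b) ≡ v * v * v + v + 3 * v * (a + b) + 2 * c3 + c1 + c2 + 2 * c4 →
      q + s + 2 * (v * v) + 2 * (a + b) ≡ v * v * v + v + 3 * v * (a + b) + 2 * c3 + (s + c1) + c2 + 2 * c4
  closing q s v a b c1 c2 c3 c4 ih = +-cancelʳ-≡-via (shuffle q s v a b c1 c2 c3 c4) ih

∑flips-#du²+#ddu+#duu : ∀ g → QuadraticFlipSum g
∑flips-#du²+#ddu+#duu []              = refl
∑flips-#du²+#ddu+#duu (u ∷ r)         =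
  trans (cong (λ z → z + 2 * (#du r * #du r) + 2 * (#ddu r + #duu r)) (∑flips-u #du²+#ddu+#duu r))
        (∑flips-#du²+#ddu+#duu r)
∑flips-#du²+#ddu+#duu (d ∷ [])        = refl
∑flips-#du²+#ddu+#duu (d ∷ u ∷ r)     = quadraticFlipSum-du r (∑flips-#du²+#ddu+#duu r)
∑flips-#du²+#ddu+#duu (d ∷ d ∷ [])    = refl
∑flips-#du²+#ddu+#duu (d ∷ d ∷ u ∷ r) = quadraticFlipSum-ddu r (∑flips-#du²+#ddu+#duu r)
∑flips-#du²+#ddu+#duu (d ∷ d ∷ d ∷ r) = quadraticFlipSum-ddd r (∑flips-#du²+#ddu+#duu (d ∷ d ∷ r))

chains-3 : ∀ g → chains 3 g + 3 * (#du g * #du g) + 3 * (#ddu g + #duu g)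
              ≡ #du g * #du g * #du g + 2 * #du g + 3 * #du g * (#ddu g + #duu g)
                + #dddu g + #duuu g + 2 * #dduu g + 2 * #dudu g
chains-3 g = closing (chains 3 g) (∑flips #du g) (∑flips #du²+#ddu+#duu g) (#du g) (#ddu g) (#duu g)
                     (#dddu g) (#duuu g) (#dduu g) (#dudu g) chains-3+∑flips-#du
                     (∑flips-#du²+#ddu+#duu g) (∑flips-#du g)
  where
  chains-3+∑flips-#du : chains 3 g + ∑flips #du g ≡ ∑flips #du²+#ddu+#duu g
  chains-3+∑flips-#du = trans (sym (∑-+ (chains 2) #du (flips g))) (∑-cong chains-2 (flips g))
  shuffle : ∀ n x q v a b c1 c2 c3 c4 →
      n + 3 * (v * v) + 3 * (a + b) + (q + (v * v * v + v + 3 * v * (a + b) + 2 * c3 + c1 + c2 + 2 * c4) + (x + v))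
      ≡ v * v * v + 2 * v + 3 * v * (a + b) + c1 + c2 + 2 * c3 + 2 * c4
        + ((n + x) + (q + 2 * (v * v) + 2 * (a + b)) + (v * v + a + b))
  shuffle = solve-∀
  closing : ∀ n x q v a b c1 c2 c3 c4 → n + x ≡ q →
      q + 2 * (v * v) + 2 * (a + b) ≡ v * v * v + v + 3 * v * (a + b) + 2 * c3 + c1 + c2 + 2 * c4 →
      x + v ≡ v * v + a + b →
      n + 3 * (v * v) + 3 * (a + b) ≡ v * v * v + 2 * v + 3 * v * (a + b) + c1 + c2 + 2 * c3 + 2 * c4
  closing n x q v a b c1 c2 c3 c4 h₁ h₂ h₃ =
    +-cancelʳ-≡-via (shuffle n x q v a b c1 c2 c3 c4) (cong₂ _+_ (cong₂ _+_ h₁ h₂) (sym h₃))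

-- Disjoint occurrences

∑-tuples-suc : ∀ (F : List ℕ → ℕ) m k →
  ∑ F (tuples m (suc k)) ≡ ∑ (λ p → ∑ (λ t → F (p ∷ t)) (tuples m k)) (upTo m)
∑-tuples-suc F m k = trans (∑-concatMap F (λ p → map (p ∷_) (tuples m k)) (upTo m))
                           (∑-cong (λ p → ∑-map F (p ∷_) (tuples m k)) (upTo m))

-- The trailing "+ 0" comes from the single empty tuple of length 0.
countB-tuples-1 : ∀ (P : List ℕ → Bool) m →
  countB P (tuples m 1) ≡ ∑ (λ p → 𝟙 (P (p ∷ [])) + 0) (upTo m)
countB-tuples-1 P m = trans (countB≡∑ P (tuples m 1)) (∑-tuples-suc (𝟙 ∘ P) m 0)

countB-tuples-2 : ∀ (P : List ℕ → Bool) m →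
  countB P (tuples m 2) ≡ ∑ (λ p → ∑ (λ q → 𝟙 (P (p ∷ q ∷ [])) + 0) (upTo m)) (upTo m)
countB-tuples-2 P m = trans (countB≡∑ P (tuples m 2)) (trans (∑-tuples-suc (𝟙 ∘ P) m 1)
  (∑-cong (λ p → ∑-tuples-suc (λ t → 𝟙 (P (p ∷ t))) m 0) (upTo m)))

countB-tuples-3 : ∀ (P : List ℕ → Bool) m →
  countB P (tuples m 3)
  ≡ ∑ (λ p → ∑ (λ q → ∑ (λ r → 𝟙 (P (p ∷ q ∷ r ∷ [])) + 0) (upTo m)) (upTo m)) (upTo m)
countB-tuples-3 P m = trans (countB≡∑ P (tuples m 3)) (trans (∑-tuples-suc (𝟙 ∘ P) m 2)
  (∑-cong (λ p → trans (∑-tuples-suc (λ t → 𝟙 (P (p ∷ t))) m 1)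
    (∑-cong (λ q → ∑-tuples-suc (λ t → 𝟙 (P (p ∷ q ∷ t))) m 0) (upTo m))) (upTo m)))

factorCount≡∑occursAt : ∀ w γ → factorCount w γ ≡ ∑ (λ p → 𝟙 (occursAt w γ p)) (upTo (length γ))
factorCount≡∑occursAt w []      = refl
factorCount≡∑occursAt w (x ∷ γ) =
  trans (cong (𝟙 (isPrefixB w (x ∷ γ)) +_) (factorCount≡∑occursAt w γ))
        (sym (∑-upTo-suc (λ p → 𝟙 (occursAt w (x ∷ γ) p)) (length γ)))

occCount-single : ∀ w γ → occCount (w ∷ []) γ ≡ factorCount w γ
occCount-single w γ = trans (countB-tuples-1 _ (length γ))
  (trans (∑-cong single (upTo (length γ))) (sym (factorCount≡∑occursAt w γ)))
  where
  single : ∀ p → 𝟙 ((occursAt w γ p ∧ true) ∧ true) + 0 ≡ 𝟙 (occursAt w γ p)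
  single p rewrite ∧-identityʳ (occursAt w γ p) | ∧-identityʳ (occursAt w γ p) = +-identityʳ _

-- Pairs with a p and b q off the shifted diagonal p = q + s, on which every b q has exactly one partner.
∑∑-off-diagonal : ∀ m (a b : ℕ → Bool) (G : ℕ → ℕ → ℕ) s →
  (∀ p q → G p q + 𝟙 (b q) * 𝟙 (p ≡ᵇ q + s) ≡ 𝟙 (a p) * 𝟙 (b q)) →
  (∀ q → b q ≡ true → (q + s <ᵇ m) ≡ true) →
  ∑ (λ p → ∑ (G p) (upTo m)) (upTo m) + ∑ (𝟙 ∘ b) (upTo m) ≡ ∑ (𝟙 ∘ a) (upTo m) * ∑ (𝟙 ∘ b) (upTo m)
∑∑-off-diagonal m a b G s split inRange =
  begin
    ∑ (λ p → ∑ (G p) U) U + ∑ (𝟙 ∘ b) U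
  ≡⟨ cong (∑ (λ p → ∑ (G p) U) U +_) (sym ∑∑-diagonal) ⟩
    ∑ (λ p → ∑ (G p) U) U + ∑ (λ p → ∑ (diagonal p) U) U
  ≡⟨ sym (∑-+ (λ p → ∑ (G p) U) (λ p → ∑ (diagonal p) U) U) ⟩
    ∑ (λ p → ∑ (G p) U + ∑ (diagonal p) U) U
  ≡⟨ ∑-cong (λ p → trans (sym (∑-+ (G p) (diagonal p) U)) (∑-cong (split p) U)) U ⟩
    ∑ (λ p → ∑ (λ q → 𝟙 (a p) * 𝟙 (b q)) U) U
  ≡⟨ ∑-cong (λ p → ∑-*ˡ (𝟙 (a p)) (𝟙 ∘ b) U) U ⟩
    ∑ (λ p → 𝟙 (a p) * ∑ (𝟙 ∘ b) U) U
  ≡⟨ ∑-*ʳ (∑ (𝟙 ∘ b) U) (𝟙 ∘ a) U ⟩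
    ∑ (𝟙 ∘ a) U * ∑ (𝟙 ∘ b) U
  ∎
  where
  open ≡-Reasoning
  U : List ℕ
  U = upTo m
  diagonal : ℕ → ℕ → ℕ
  diagonal p q = 𝟙 (b q) * 𝟙 (p ≡ᵇ q + s)
  one-on-diagonal : ∀ q → 𝟙 (b q) * 𝟙 (q + s <ᵇ m) ≡ 𝟙 (b q)
  one-on-diagonal q with b q in bq
  ... | false = refl
  ... | true  rewrite inRange q bq = refl
  ∑∑-diagonal : ∑ (λ p → ∑ (diagonal p) U) U ≡ ∑ (𝟙 ∘ b) U
  ∑∑-diagonal = trans (∑-swap diagonal U U)
    (∑-cong (λ q → trans (∑-*ˡ (𝟙 (b q)) (λ p → 𝟙 (p ≡ᵇ q + s)) U)
                   (trans (cong (𝟙 (b q) *_) (∑-upTo-≡ᵇ m (q + s))) (one-on-diagonal q))) U)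

-- The indicator of an admissible pair (a, b, disjoint D), shaped as occCount produces it for two distinct words.
pair-indicator-split : ∀ a b D δ → (b ≡ true → δ ≡ not D ∧ a) →
  𝟙 ((a ∧ (b ∧ true)) ∧ (((D ∧ true) ∧ true) ∧ true)) + 0 + 𝟙 b * 𝟙 δ ≡ 𝟙 a * 𝟙 b
pair-indicator-split true  false D     δ _ = refl
pair-indicator-split false false D     δ _ = refl
pair-indicator-split a     true  D     δ h rewrite h refl = by-cases a D
  where
  by-cases : ∀ a D → 𝟙 ((a ∧ true) ∧ (((D ∧ true) ∧ true) ∧ true)) + 0 + 1 * 𝟙 (not D ∧ a) ≡ 𝟙 a * 1
  by-cases true  true  = refl
  by-cases true  false = refl
  by-cases false true  = refl
  by-cases false false = refl

-- The position of p relative to q, fine enough to decide overlaps of factors of length at most 3.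
data Offset : ℕ → ℕ → Set where
  before₂₊ : ∀ p k → Offset p (p + suc (suc k))
  before₁  : ∀ p → Offset p (p + 1)
  same     : ∀ q → Offset q q
  after₁   : ∀ q → Offset (q + 1) q
  after₂   : ∀ q → Offset (q + 2) q
  after₃₊  : ∀ q k → Offset (q + suc (suc (suc k))) q

offset-suc : ∀ {p q} → Offset p q → Offset (suc p) (suc q)
offset-suc (before₂₊ p k) = before₂₊ (suc p) k
offset-suc (before₁ p)    = before₁ (suc p)
offset-suc (same q)       = same (suc q)
offset-suc (after₁ q)     = after₁ (suc q)
offset-suc (after₂ q)     = after₂ (suc q)
offset-suc (after₃₊ q k)  = after₃₊ (suc q) k

offset : ∀ p q → Offset p q
offset zero                zero          = same 0
offset zero                (suc zero)    = before₁ 0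
offset zero                (suc (suc k)) = before₂₊ 0 k
offset (suc zero)          zero          = after₁ 0
offset (suc (suc zero))    zero          = after₂ 0
offset (suc (suc (suc k))) zero          = after₃₊ 0 k
offset (suc p)             (suc q)       = offset-suc (offset p q)

≤ᵇ-suc : ∀ m n → (suc m ≤ᵇ suc n) ≡ (m ≤ᵇ n)
≤ᵇ-suc zero    n = refl
≤ᵇ-suc (suc m) n = refl

≤ᵇ-+ˡ : ∀ b m n → (b + m ≤ᵇ b + n) ≡ (m ≤ᵇ n)
≤ᵇ-+ˡ zero    m n = refl
≤ᵇ-+ˡ (suc b) m n = trans (≤ᵇ-suc (b + m) (b + n)) (≤ᵇ-+ˡ b m n)

<ᵇ-+ˡ : ∀ b m n → (b + m <ᵇ b + n) ≡ (m <ᵇ n)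
<ᵇ-+ˡ zero    m n = refl
<ᵇ-+ˡ (suc b) m n = <ᵇ-+ˡ b m n

≡ᵇ-+ˡ : ∀ b m n → (b + m ≡ᵇ b + n) ≡ (m ≡ᵇ n)
≡ᵇ-+ˡ zero    m n = refl
≡ᵇ-+ˡ (suc b) m n = ≡ᵇ-+ˡ b m n

≤ᵇ-offset : ∀ b {x y} m n → x ≡ b + m → y ≡ b + n → (x ≤ᵇ y) ≡ (m ≤ᵇ n)
≤ᵇ-offset b m n refl refl = ≤ᵇ-+ˡ b m n

<ᵇ-offset : ∀ b {x y} m n → x ≡ b + m → y ≡ b + n → (x <ᵇ y) ≡ (m <ᵇ n)
<ᵇ-offset b m n refl refl = <ᵇ-+ˡ b m n

≡ᵇ-offset : ∀ b {x y} m n → x ≡ b + m → y ≡ b + n → (x ≡ᵇ y) ≡ (m ≡ᵇ n)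
≡ᵇ-offset b m n refl refl = ≡ᵇ-+ˡ b m n

no-du-before-d : ∀ x (r : Word) → isPrefixB du (x ∷ d ∷ r) ≡ false
no-du-before-d u r = refl
no-du-before-d d r = refl

overlap-by-values : ∀ {δ D₁ D₂ a δ′ D₁′ D₂′ a′} → δ ≡ δ′ → D₁ ≡ D₁′ → D₂ ≡ D₂′ → a ≡ a′ →
  δ′ ≡ not (D₁′ ∨ D₂′) ∧ a′ → δ ≡ not (D₁ ∨ D₂) ∧ a
overlap-by-values refl refl refl refl e = e

n≡n+0 : ∀ n → n ≡ n + 0
n≡n+0 n = sym (+-identityʳ n)

-- Given an occurrence of ddu at q, the only valley meeting it is the one at q + 1.
overlap-ddu : ∀ γ p q → occursAt ddu γ q ≡ true →
  (p ≡ᵇ q + 1) ≡ not ((p + 2 ≤ᵇ q) ∨ (q + 3 ≤ᵇ p)) ∧ occursAt du γ p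
overlap-ddu γ p q occ with isPrefixB-sound ddu (drop q γ) occ
... | r , at-q with offset p q
... | before₂₊ p k = overlap-by-values (≡ᵇ-offset p 0 (suc (suc k) + 1) (n≡n+0 p) (+-assoc p (suc (suc k)) 1))
                       (≤ᵇ-offset p 2 (suc (suc k)) refl refl) refl refl refl
... | before₁ p = overlap-by-values (≡ᵇ-offset p 0 2 (n≡n+0 p) (+-assoc p 1 1)) (≤ᵇ-offset p 2 1 refl refl)
                    (≤ᵇ-offset p 4 0 (+-assoc p 1 3) (n≡n+0 p)) not-valley refl
  where
  not-valley : occursAt du γ p ≡ false
  not-valley with drop-pred p γ at-q
  ... | x , at-p = trans (cong (isPrefixB du) at-p) (no-du-before-d x (d ∷ u ∷ r))
... | same q = overlap-by-values (≡ᵇ-offset q 0 1 (n≡n+0 q) refl) (≤ᵇ-offset q 2 0 refl (n≡n+0 q))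
                 (≤ᵇ-offset q 3 0 refl (n≡n+0 q)) (cong (isPrefixB du) at-q) refl
... | after₁ q = overlap-by-values (≡ᵇ-offset q 1 1 refl refl) (≤ᵇ-offset q 3 0 (+-assoc q 1 2) (n≡n+0 q))
                   (≤ᵇ-offset q 3 1 refl refl) (cong (isPrefixB du) (trans (drop-+ q 1 γ) (cong (drop 1) at-q))) refl
... | after₂ q = overlap-by-values (≡ᵇ-offset q 2 1 refl refl) (≤ᵇ-offset q 4 0 (+-assoc q 2 2) (n≡n+0 q))
                   (≤ᵇ-offset q 3 2 refl refl) (cong (isPrefixB du) (trans (drop-+ q 2 γ) (cong (drop 2) at-q))) refl
... | after₃₊ q k = overlap-by-values (≡ᵇ-offset q (suc (suc (suc k))) 1 refl refl)
                      (≤ᵇ-offset q (suc (suc (suc k)) + 2) 0 (+-assoc q _ 2) (n≡n+0 q))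
                      (≤ᵇ-offset q 3 (suc (suc (suc k))) refl refl) refl refl

-- Given an occurrence of duu at q, the only valley meeting it is the one at q.
overlap-duu : ∀ γ p q → occursAt duu γ q ≡ true →
  (p ≡ᵇ q + 0) ≡ not ((p + 2 ≤ᵇ q) ∨ (q + 3 ≤ᵇ p)) ∧ occursAt du γ p
overlap-duu γ p q occ with isPrefixB-sound duu (drop q γ) occ
... | r , at-q with offset p q
... | before₂₊ p k = overlap-by-values (≡ᵇ-offset p 0 (suc (suc k)) (n≡n+0 p) (+-identityʳ _))
                       (≤ᵇ-offset p 2 (suc (suc k)) refl refl) refl refl refl
... | before₁ p = overlap-by-values (≡ᵇ-offset p 0 1 (n≡n+0 p) (+-identityʳ _)) (≤ᵇ-offset p 2 1 refl refl)
                    (≤ᵇ-offset p 4 0 (+-assoc p 1 3) (n≡n+0 p)) not-valley refl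
  where
  not-valley : occursAt du γ p ≡ false
  not-valley with drop-pred p γ at-q
  ... | x , at-p = trans (cong (isPrefixB du) at-p) (no-du-before-d x (u ∷ u ∷ r))
... | same q = overlap-by-values (≡ᵇ-offset q 0 0 (n≡n+0 q) refl) (≤ᵇ-offset q 2 0 refl (n≡n+0 q))
                 (≤ᵇ-offset q 3 0 refl (n≡n+0 q)) (cong (isPrefixB du) at-q) refl
... | after₁ q = overlap-by-values (≡ᵇ-offset q 1 0 refl refl) (≤ᵇ-offset q 3 0 (+-assoc q 1 2) (n≡n+0 q))
                   (≤ᵇ-offset q 3 1 refl refl) (cong (isPrefixB du) (trans (drop-+ q 1 γ) (cong (drop 1) at-q))) refl
... | after₂ q = overlap-by-values (≡ᵇ-offset q 2 0 refl refl) (≤ᵇ-offset q 4 0 (+-assoc q 2 2) (n≡n+0 q))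
                   (≤ᵇ-offset q 3 2 refl refl) (cong (isPrefixB du) (trans (drop-+ q 2 γ) (cong (drop 2) at-q))) refl
... | after₃₊ q k = overlap-by-values (≡ᵇ-offset q (suc (suc (suc k))) 0 refl refl)
                      (≤ᵇ-offset q (suc (suc (suc k)) + 2) 0 (+-assoc q _ 2) (n≡n+0 q))
                      (≤ᵇ-offset q 3 (suc (suc (suc k))) refl refl) refl refl

occCount-du-ddu : ∀ γ → occCount (du ∷ ddu ∷ []) γ + #ddu γ ≡ #du γ * #ddu γ
occCount-du-ddu γ =
  trans (cong₂ _+_ (countB-tuples-2 _ (length γ)) (factorCount≡∑occursAt ddu γ))
  (trans (∑∑-off-diagonal (length γ) (occursAt du γ) (occursAt ddu γ) _ 1
           (λ p q → pair-indicator-split (occursAt du γ p) (occursAt ddu γ q) _ (p ≡ᵇ q + 1) (overlap-ddu γ p q))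
           in-range)
         (sym (cong₂ _*_ (factorCount≡∑occursAt du γ) (factorCount≡∑occursAt ddu γ))))
  where
  in-range : ∀ q → occursAt ddu γ q ≡ true → (q + 1 <ᵇ length γ) ≡ true
  in-range q occ with isPrefixB-sound ddu (drop q γ) occ
  ... | r , at-q = drop-nonempty (q + 1) γ (trans (drop-+ q 1 γ) (cong (drop 1) at-q))

occCount-du-duu : ∀ γ → occCount (du ∷ duu ∷ []) γ + #duu γ ≡ #du γ * #duu γ
occCount-du-duu γ =
  trans (cong₂ _+_ (countB-tuples-2 _ (length γ)) (factorCount≡∑occursAt duu γ))
  (trans (∑∑-off-diagonal (length γ) (occursAt du γ) (occursAt duu γ) _ 0
           (λ p q → pair-indicator-split (occursAt du γ p) (occursAt duu γ q) _ (p ≡ᵇ q + 0) (overlap-duu γ p q))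
           in-range)
         (sym (cong₂ _*_ (factorCount≡∑occursAt du γ) (factorCount≡∑occursAt duu γ))))
  where
  in-range : ∀ q → occursAt duu γ q ≡ true → (q + 0 <ᵇ length γ) ≡ true
  in-range q occ with isPrefixB-sound duu (drop q γ) occ
  ... | r , at-q = drop-nonempty (q + 0) γ (trans (drop-+ q 0 γ) at-q)

#marked #markedPairs #markedTriples : (ℕ → Bool) → ℕ → ℕ
#marked a m = ∑ (𝟙 ∘ a) (upTo m)
#markedPairs a m = ∑ (λ p → ∑ (λ q → 𝟙 ((p <ᵇ q) ∧ (a p ∧ a q))) (upTo m)) (upTo m)
#markedTriples a m =
  ∑ (λ p → ∑ (λ q → ∑ (λ r → 𝟙 ((q <ᵇ r) ∧ ((p <ᵇ q) ∧ (a p ∧ (a q ∧ a r))))) (upTo m)) (upTo m)) (upTo m)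

#marked-suc : ∀ a m → #marked a (suc m) ≡ 𝟙 (a 0) + #marked (a ∘ suc) m
#marked-suc a m = ∑-upTo-suc (𝟙 ∘ a) m

#markedPairs-suc : ∀ a m → #markedPairs a (suc m) ≡ 𝟙 (a 0) * #marked (a ∘ suc) m + #markedPairs (a ∘ suc) m
#markedPairs-suc a m =
  trans (∑-upTo-suc (λ p → ∑ (λ q → 𝟙 ((p <ᵇ q) ∧ (a p ∧ a q))) (upTo (suc m))) m)
        (cong₂ _+_ first (∑-cong (λ p → ∑-upTo-suc (λ q → 𝟙 ((suc p <ᵇ q) ∧ (a (suc p) ∧ a q))) m) (upTo m)))
  where
  first : ∑ (λ q → 𝟙 ((0 <ᵇ q) ∧ (a 0 ∧ a q))) (upTo (suc m)) ≡ 𝟙 (a 0) * #marked (a ∘ suc) m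
  first = trans (∑-upTo-suc (λ q → 𝟙 ((0 <ᵇ q) ∧ (a 0 ∧ a q))) m)
    (trans (∑-cong (λ q → 𝟙-∧ (a 0) (a (suc q))) (upTo m)) (∑-*ˡ (𝟙 (a 0)) (𝟙 ∘ a ∘ suc) (upTo m)))

#markedTriples-suc : ∀ a m →
  #markedTriples a (suc m) ≡ 𝟙 (a 0) * #markedPairs (a ∘ suc) m + #markedTriples (a ∘ suc) m
#markedTriples-suc a m =
  trans (∑-upTo-suc (λ p → ∑ (λ q → ∑ (triple p q) (upTo (suc m))) (upTo (suc m))) m) (cong₂ _+_ first rest)
  where
  U : List ℕ
  U = upTo m
  triple : ℕ → ℕ → ℕ → ℕ
  triple p q r = 𝟙 ((q <ᵇ r) ∧ ((p <ᵇ q) ∧ (a p ∧ (a q ∧ a r))))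
  pull-out : ∀ x y z → 𝟙 (x ∧ (y ∧ z)) ≡ 𝟙 y * 𝟙 (x ∧ z)
  pull-out true  true  z = sym (+-identityʳ _)
  pull-out true  false z = refl
  pull-out false true  z = sym (+-identityʳ _)
  pull-out false false z = refl
  first : ∑ (λ q → ∑ (triple 0 q) (upTo (suc m))) (upTo (suc m)) ≡ 𝟙 (a 0) * #markedPairs (a ∘ suc) m
  first = trans (∑-upTo-suc (λ q → ∑ (triple 0 q) (upTo (suc m))) m) (cong₂ _+_
    (trans (∑-upTo-suc (triple 0 0) m) (∑-zero U))
    (trans (∑-cong (λ q → trans (∑-upTo-suc (triple 0 (suc q)) m)
              (trans (∑-cong (λ r → pull-out (q <ᵇ r) (a 0) (a (suc q) ∧ a (suc r))) U)
                     (∑-*ˡ (𝟙 (a 0)) (λ r → 𝟙 ((q <ᵇ r) ∧ (a (suc q) ∧ a (suc r)))) U))) U)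
           (∑-*ˡ (𝟙 (a 0)) (λ q → ∑ (λ r → 𝟙 ((q <ᵇ r) ∧ (a (suc q) ∧ a (suc r)))) U) U)))
  rest : ∑ (λ p → ∑ (λ q → ∑ (triple (suc p) q) (upTo (suc m))) (upTo (suc m))) U ≡ #markedTriples (a ∘ suc) m
  rest = ∑-cong (λ p → trans (∑-upTo-suc (λ q → ∑ (triple (suc p) q) (upTo (suc m))) m) (cong₂ _+_
           (trans (∑-upTo-suc (triple (suc p) 0) m) (∑-zero U))
           (∑-cong (λ q → ∑-upTo-suc (triple (suc p) (suc q)) m) U))) U

#markedPairs-identity : ∀ a m → 2 * #markedPairs a m + #marked a m ≡ #marked a m * #marked a m
#markedPairs-identity a zero = refl
#markedPairs-identity a (suc m) rewrite #markedPairs-suc a m | #marked-suc a m with a 0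
... | true  = +-cancelʳ-≡-via (shuffle (#marked (a ∘ suc) m) (#markedPairs (a ∘ suc) m))
                              (#markedPairs-identity (a ∘ suc) m)
  where
  shuffle : ∀ s₁ s₂ → 2 * (1 * s₁ + s₂) + (1 + s₁) + s₁ * s₁ ≡ (1 + s₁) * (1 + s₁) + (2 * s₂ + s₁)
  shuffle = solve-∀
... | false = #markedPairs-identity (a ∘ suc) m

#markedTriples-identity : ∀ a m →
  6 * #markedTriples a m + 3 * (#marked a m * #marked a m) ≡ #marked a m * #marked a m * #marked a m + 2 * #marked a m
#markedTriples-identity a zero = refl
#markedTriples-identity a (suc m) rewrite #markedTriples-suc a m | #marked-suc a m with a 0
... | true  = +-cancelʳ-≡-via (shuffle (#marked (a ∘ suc) m) (#markedPairs (a ∘ suc) m) (#markedTriples (a ∘ suc) m))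
                (cong₂ _+_ (#markedTriples-identity (a ∘ suc) m) (cong (3 *_) (#markedPairs-identity (a ∘ suc) m)))
  where
  shuffle : ∀ s₁ s₂ s₃ →
    6 * (1 * s₂ + s₃) + 3 * ((1 + s₁) * (1 + s₁)) + ((s₁ * s₁ * s₁ + 2 * s₁) + 3 * (s₁ * s₁))
    ≡ (1 + s₁) * (1 + s₁) * (1 + s₁) + 2 * (1 + s₁) + ((6 * s₃ + 3 * (s₁ * s₁)) + 3 * (2 * s₂ + s₁))
  shuffle = solve-∀
... | false = #markedTriples-identity (a ∘ suc) m

valley-not-next : ∀ γ x → occursAt du γ x ≡ true → occursAt du γ (x + 1) ≡ false
valley-not-next γ x occ with isPrefixB-sound du (drop x γ) occ
... | r , at-x = cong (isPrefixB du) (trans (drop-+ x 1 γ) (cong (drop 1) at-x))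

disjoint-by-values : ∀ {D₁ D₂ l D₁′ D₂′ l′} → D₁ ≡ D₁′ → D₂ ≡ D₂′ → l ≡ l′ →
  (D₁′ ∨ D₂′) ∧ l′ ≡ l′ → (D₁ ∨ D₂) ∧ l ≡ l
disjoint-by-values refl refl refl e = e

-- Two valleys are never adjacent, so distinct valleys are automatically disjoint occurrences of du.
valleys-disjoint : ∀ γ x y → occursAt du γ x ≡ true → occursAt du γ y ≡ true →
  ((x + 2 ≤ᵇ y) ∨ (y + 2 ≤ᵇ x)) ∧ (x <ᵇ y) ≡ (x <ᵇ y)
valleys-disjoint γ x y vx vy with offset x y
... | before₂₊ x k = disjoint-by-values (≤ᵇ-offset x 2 (suc (suc k)) refl refl) refl
                       (<ᵇ-offset x 0 (suc (suc k)) (n≡n+0 x) refl) refl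
... | before₁ x with () ← trans (sym vy) (valley-not-next γ x vx)
... | same x = disjoint-by-values (≤ᵇ-offset x 2 0 refl (n≡n+0 x)) (≤ᵇ-offset x 2 0 refl (n≡n+0 x))
                 (<ᵇ-offset x 0 0 (n≡n+0 x) (n≡n+0 x)) refl
... | after₁ y with () ← trans (sym vx) (valley-not-next γ y vy)
... | after₂ y = disjoint-by-values (≤ᵇ-offset y 4 0 (+-assoc y 2 2) (n≡n+0 y)) (≤ᵇ-offset y 2 2 refl refl)
                   (<ᵇ-offset y 2 0 refl (n≡n+0 y)) refl
... | after₃₊ y k = disjoint-by-values (≤ᵇ-offset y (suc (suc (suc k)) + 2) 0 (+-assoc y _ 2) (n≡n+0 y))
                      (≤ᵇ-offset y 2 (suc (suc (suc k))) refl refl) (<ᵇ-offset y (suc (suc (suc k))) 0 refl (n≡n+0 y)) refl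

<ᵇ-trans : ∀ p q r → (p <ᵇ q) ≡ true → (q <ᵇ r) ≡ true → (p <ᵇ r) ≡ true
<ᵇ-trans zero    (suc q) (suc r) _ _ = refl
<ᵇ-trans (suc p) (suc q) (suc r) e₁ e₂ = <ᵇ-trans p q r e₁ e₂

ordered-triple : ∀ x y z → (x ≡ true → y ≡ true → z ≡ true) →
  𝟙 ((x ∧ (z ∧ true)) ∧ ((y ∧ true) ∧ true)) + 0 ≡ 𝟙 (y ∧ (x ∧ true))
ordered-triple true  true  z     trans rewrite trans refl refl = refl
ordered-triple true  false true  _ = refl
ordered-triple true  false false _ = refl
ordered-triple false true  z     _ = refl
ordered-triple false false z     _ = refl

occCount-du-du-du : ∀ γ → occCount (du ∷ du ∷ du ∷ []) γ ≡ #markedTriples (occursAt du γ) (length γ)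
occCount-du-du-du γ = trans (countB-tuples-3 _ (length γ))
  (∑-cong (λ p → ∑-cong (λ q → ∑-cong (λ r → triple p q r) U) U) U)
  where
  U : List ℕ
  U = upTo (length γ)
  triple : ∀ p q r →
    𝟙 ((occursAt du γ p ∧ (occursAt du γ q ∧ (occursAt du γ r ∧ true)))
       ∧ (((((p + 2 ≤ᵇ q) ∨ (q + 2 ≤ᵇ p)) ∧ (p <ᵇ q)) ∧ ((((p + 2 ≤ᵇ r) ∨ (r + 2 ≤ᵇ p)) ∧ (p <ᵇ r)) ∧ true))
          ∧ (((((q + 2 ≤ᵇ r) ∨ (r + 2 ≤ᵇ q)) ∧ (q <ᵇ r)) ∧ true) ∧ true))) + 0
    ≡ 𝟙 ((q <ᵇ r) ∧ ((p <ᵇ q) ∧ (occursAt du γ p ∧ (occursAt du γ q ∧ occursAt du γ r))))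
  unmarked : ∀ x y → 0 ≡ 𝟙 (x ∧ (y ∧ false))
  unmarked x y = cong 𝟙 (sym (trans (cong (x ∧_) (∧-zeroʳ y)) (∧-zeroʳ x)))
  triple p q r with occursAt du γ p in vp | occursAt du γ q in vq | occursAt du γ r in vr
  ... | true  | true  | true
    rewrite valleys-disjoint γ p q vp vq | valleys-disjoint γ p r vp vr | valleys-disjoint γ q r vq vr
    = ordered-triple (p <ᵇ q) (q <ᵇ r) (p <ᵇ r) (<ᵇ-trans p q r)
  ... | false | _     | _     = unmarked (q <ᵇ r) (p <ᵇ q)
  ... | true  | false | _     = unmarked (q <ᵇ r) (p <ᵇ q)
  ... | true  | true  | false = unmarked (q <ᵇ r) (p <ᵇ q)

occCount-du-du-du-identity : ∀ γ →
  6 * occCount (du ∷ du ∷ du ∷ []) γ + 3 * (#du γ * #du γ) ≡ #du γ * #du γ * #du γ + 2 * #du γ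
occCount-du-du-du-identity γ rewrite occCount-du-du-du γ | factorCount≡∑occursAt du γ =
  #markedTriples-identity (occursAt du γ) (length γ)

chains-3≡summand : ∀ γ → chains 3 γ ≡ summand γ
chains-3≡summand γ =
  trans (closing (chains 3 γ) (occCount (du ∷ du ∷ du ∷ []) γ) (occCount (du ∷ ddu ∷ []) γ)
                 (occCount (du ∷ duu ∷ []) γ) (#dddu γ) (#duuu γ) (#dduu γ) (#dudu γ) (#du γ) (#ddu γ) (#duu γ)
                 (chains-3 γ) (occCount-du-du-du-identity γ) (occCount-du-ddu γ) (occCount-du-duu γ))
        (sym summand-by-factors)
  where
  summand-by-factors : summand γ ≡ 6 * occCount (du ∷ du ∷ du ∷ []) γ + 3 * occCount (du ∷ ddu ∷ []) γ
                                   + 3 * occCount (du ∷ duu ∷ []) γ + #dddu γ + #duuu γ + 2 * #dduu γ + 2 * #dudu γ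
  summand-by-factors rewrite occCount-single dddu γ | occCount-single duuu γ
                           | occCount-single dduu γ | occCount-single dudu γ = refl
  shuffle : ∀ n o₃ o₂ o₂′ c₁ c₂ c₃ c₄ v a b →
      n + ((v * v * v + 2 * v + 3 * v * (a + b) + c₁ + c₂ + 2 * c₃ + 2 * c₄) + (6 * o₃ + 3 * (v * v))
           + 3 * (o₂ + a) + 3 * (o₂′ + b))
      ≡ 6 * o₃ + 3 * o₂ + 3 * o₂′ + c₁ + c₂ + 2 * c₃ + 2 * c₄
        + ((n + 3 * (v * v) + 3 * (a + b)) + (v * v * v + 2 * v) + 3 * (v * a) + 3 * (v * b))
  shuffle = solve-∀
  closing : ∀ n o₃ o₂ o₂′ c₁ c₂ c₃ c₄ v a b →
      n + 3 * (v * v) + 3 * (a + b) ≡ v * v * v + 2 * v + 3 * v * (a + b) + c₁ + c₂ + 2 * c₃ + 2 * c₄ →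
      6 * o₃ + 3 * (v * v) ≡ v * v * v + 2 * v → o₂ + a ≡ v * a → o₂′ + b ≡ v * b →
      n ≡ 6 * o₃ + 3 * o₂ + 3 * o₂′ + c₁ + c₂ + 2 * c₃ + 2 * c₄
  closing n o₃ o₂ o₂′ c₁ c₂ c₃ c₄ v a b h₁ h₃ h₂ h₂′ =
    +-cancelʳ-≡-via (shuffle n o₃ o₂ o₂′ c₁ c₂ c₃ c₄ v a b)
      (cong₂ _+_ (cong₂ _+_ (cong₂ _+_ h₁ (sym h₃)) (cong (3 *_) (sym h₂))) (cong (3 *_) (sym h₂′)))

mainTheorem5 : (n : ℕ) → sc3 n ≡ sum (map summand (Dyck n))
mainTheorem5 n =
  begin
    sc3 n
  ≡⟨ sc3≡∑coverChains n ⟩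
    ∑ (coverChains n 3) (Dyck n)
  ≡⟨ ∑-cong-∈ (Dyck n) (λ p → coverChains≡chains n 3 _ (∈Dyck→InDyck n p)) ⟩
    ∑ (chains 3) (Dyck n)
  ≡⟨ ∑-cong chains-3≡summand (Dyck n) ⟩
    ∑ summand (Dyck n)
  ∎
  where open ≡-Reasoning
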